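{- Let $r,c\ge2$ and $m\ge0$ be integers. Let $P$ be a Hamiltonian path in the $r\times c$ cylinder graph that starts at $(0,0)$ and ends at $(x,c-1)$ for some row $x$. Suppose that $P$ uses exactly $2m+1$ horizontal edges between columns $0$ and $1$, and exactly one horizontal edge between columns $j$ and $j+1$ for every $1\le j\le c-2$. Then $x\in A_{r,c,m}$.
   Context: An $r\times c$ cylinder graph has vertices $(i,j)$, $0\le i\le r-1$, $0\le j\le c-1$; $(i,j)$ is adjacent to $(i,j\pm1)$ when that column index lies in $\{0,\dots,c-1\}$ (horizontal edges) and to $(i\pm1\bmod r,j)$ (vertical edges). A GG path with $2k+1+(c-2)$ horizontal edges ($k\ge0$) is a Hamiltonian path of one of two forms. Form 1: starts at $(0,0)$; uses $r-2k-1$ vertical edges along $(0,0),(1,0),\dots,(r-2k-1,0)$; then alternates horizontal and vertical edges using $2k+1$ horizontal edges along $(r-2k-1,0),(r-2k-1,1),(r-2k,1),(r-2k,0),(r-2k+1,0),\dots,(r-1,0),(r-1,1)$; then traverses the remaining vertices column by column (traverse a column, take one horizontal edge to the next column, traverse it, etc.), ending in the last column and using $c-2$ further horizontal edges. Form 2: starts at $(0,0)$; uses $r-2k-1$ vertical edges along $(0,0),(r-1,0),\dots,(2k+1,0)$; then alternates along $(2k+1,0),(2k+1,1),(2k,1),(2k,0),\dots,(1,0),(1,1)$ using $2k+1$ horizontal edges; then traverses the remaining vertices column by column as in Form 1. $A_{r,c,m}$ is the set of row indices $x$ such that some GG path in the $r\times c$ cylinder graph using at most $2m+(c-1)$ horizontal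 edges ends at $(x,c-1)$. -}

module Defs where

open import Data.Nat using (ℕ; zero; suc; _+_; _*_; _∸_; _≤_; _<_; _≡ᵇ_)
open import Data.Bool using (Bool; true; false; if_then_else_; _∧_; _∨_; not)
open import Data.Product using (_×_; _,_; proj₁; proj₂; ∃; ∃-syntax)
open import Data.Sum using (_⊎_)
open import Data.List using (List; []; _∷_; _++_; map; upTo; _∷ʳ_)
open import Data.List.Relation.Unary.All using (All)
open import Data.List.Relation.Unary.Linked using (Linked)
open import Data.List.Relation.Unary.Unique.Propositional using (Unique)
open import Data.List.Membership.Propositional using (_∈_)
open import Relation.Binary.PropositionalEquality using (_≡_)

V : Set
V = ℕ × ℕ

row col : V → ℕ
row = proj₁
col = proj₂

InRange : ℕ → ℕ → V → Set
InRange r c (i , j) = i < r × j < c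

-- Adjacency in the r × c cylinder graph (columns are a path, rows are a cycle mod r).
Adj : ℕ → ℕ → V → V → Set
Adj r c (i , j) (i' , j') =
  InRange r c (i , j) × InRange r c (i' , j') ×
  ( (i ≡ i' × (suc j ≡ j' ⊎ suc j' ≡ j))
  ⊎ (j ≡ j' × (suc i ≡ i' ⊎ suc i' ≡ i ⊎ (i ≡ 0 × suc i' ≡ r) ⊎ (i' ≡ 0 × suc i ≡ r))) )

HamPath : ℕ → ℕ → List V → Set
HamPath r c P =
  Unique P × All (InRange r c) P ×
  (∀ i j → i < r → j < c → (i , j) ∈ P) ×
  Linked (Adj r c) P

StartsAt : List V → V → Set
StartsAt P v = ∃[ Q ] P ≡ v ∷ Q

EndsAt : List V → V → Set
EndsAt P v = ∃[ Q ] P ≡ Q ∷ʳ v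

isHj : ℕ → V → V → Bool
isHj j u v = ((col u ≡ᵇ j) ∧ (col v ≡ᵇ suc j)) ∨ ((col v ≡ᵇ j) ∧ (col u ≡ᵇ suc j))

hcount : ℕ → List V → ℕ
hcount j [] = 0
hcount j (u ∷ []) = 0
hcount j (u ∷ v ∷ rest) = (if isHj j u v then 1 else 0) + hcount j (v ∷ rest)

hTotal : List V → ℕ
hTotal [] = 0
hTotal (u ∷ []) = 0
hTotal (u ∷ v ∷ rest) = (if col u ≡ᵇ col v then 0 else 1) + hTotal (v ∷ rest)

alt : Bool → List ℕ → List V
alt b [] = []
alt true  (a ∷ as) = (a , 0) ∷ (a , 1) ∷ alt false as
alt false (a ∷ as) = (a , 1) ∷ (a , 0) ∷ alt true as

wrap : ℕ → ℕ → ℕ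
wrap r a = if a ≡ᵇ r then 0 else a

-- Form 1 initial segment: (0,0),…,(r-2k-2,0) then the alternating block on rows r-2k-1,…,r-1
prefix1 : ℕ → ℕ → List V
prefix1 r k =
  map (λ i → (i , 0)) (upTo (r ∸ (2 * k + 1))) ++
  alt true (map (λ t → r ∸ (2 * k + 1) + t) (upTo (2 * k + 1)))

-- Form 2 initial segment: (0,0),(r-1,0),…,(2k+2,0) then the alternating block on rows 2k+1,2k,…,1
prefix2 : ℕ → ℕ → List V
prefix2 r k =
  map (λ i → (wrap r (r ∸ i) , 0)) (upTo (r ∸ (2 * k + 1))) ++
  alt true (map (λ t → wrap r (2 * k + 1 ∸ t)) (upTo (2 * k + 1)))

ColumnByColumn : List V → Set
ColumnByColumn rest = All (λ v → 1 ≤ col v) rest × Linked (λ u v → col u ≤ col v) rest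

IsGG : ℕ → ℕ → ℕ → List V → Set
IsGG r c k P =
  2 * k + 1 ≤ r × HamPath r c P × hTotal P ≡ 2 * k + 1 + (c ∸ 2) ×
  (∃[ rest ] ((P ≡ prefix1 r k ++ rest ⊎ P ≡ prefix2 r k ++ rest) × ColumnByColumn rest))

InA : ℕ → ℕ → ℕ → ℕ → Set
InA r c m x = ∃[ P ] ∃[ k ] (IsGG r c k P × hTotal P ≤ 2 * m + (c ∸ 1) × EndsAt P (x , c ∸ 1))

-- Since every gap between columns j and j + 1 (j ≥ 1) is crossed exactly once, the path P leaves the first two
-- columns once, from some (a , 1) to (a , 2), and never returns: it is a Hamiltonian path of the two-column
-- ladder from (0 , 0) to (a , 1) followed by a column-monotone tail ending at (x , c - 1). In the ladder,
-- every vertex other than the two ends has degree 2, so the vertical edges used in the two columns agree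
-- on one side of row a and disagree on the other, where every rung must be used; parity forces an odd
-- block of 2k + 1 ≤ 2m + 1 rungs, in rows 1 , … , a - 1 or in rows a + 1 , … , r - 1. So (a , 1) is where the
-- first two columns of a GG path of Form 2 or Form 1 for this k are left (a = 0 and r = 2 being degenerate
-- instances of Form 1), and attaching the tail of P to that path gives a GG path ending at (x , c - 1).

module Submission where

open import Defs
open import Data.Bool using (Bool; true; false; if_then_else_; not; _∧_; _∨_)
open import Data.Bool.Properties using (∨-comm; ∨-zeroʳ; ∨-identityʳ; ∧-identityʳ; ∧-zeroʳ; not-involutive)
open import Data.Empty using (⊥; ⊥-elim)
open import Data.List using (List; []; _∷_; _++_; _∷ʳ_; [_]; length; null; applyUpTo; initLast; _∷ʳ′_)
open import Data.List.Properties using (++-assoc; ++-identityʳ; ∷-injectiveˡ; ∷-injectiveʳ; ∷ʳ-injectiveʳ; map-upTo; applyUpTo-∷ʳ; length-applyUpTo)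
open import Data.List.Membership.Propositional using (_∈_; _∉_)
open import Data.List.Membership.Propositional.Properties using (∈-++⁺ˡ; ∈-++⁺ʳ; ∈-++⁻; ∈-∃++; ∈-applyUpTo⁺; ∈-applyUpTo⁻)
open import Data.List.Relation.Unary.All as All using (All; []; _∷_)
import Data.List.Relation.Unary.All.Properties as All
open import Data.List.Relation.Unary.Any using (here; there)
open import Data.List.Relation.Unary.Linked as Linked using (Linked; []; [-]; _∷_)
import Data.List.Relation.Unary.Linked.Properties as Linked
open import Data.List.Relation.Unary.Unique.Propositional using (Unique; []; _∷_)
import Data.List.Relation.Unary.Unique.Propositional.Properties as Unique
open import Data.Nat using (ℕ; zero; suc; _+_; _*_; _∸_; _≤_; _<_; _≡ᵇ_; s≤s; z≤n)
open import Data.Nat.Properties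
open import Algebra.Properties.CommutativeSemigroup +-commutativeSemigroup using (interchange)
open import Data.Product using (_×_; _,_; proj₁; proj₂; ∃-syntax; ∃₂)
open import Data.Product.Properties using (,-injectiveˡ; ,-injectiveʳ)
open import Data.Sum using (_⊎_; inj₁; inj₂; [_,_]′)
open import Function using (_∘_)
open import Relation.Nullary using (¬_; yes; no)
open import Relation.Binary.PropositionalEquality hiding ([_])


⟦_⟧ : Bool → ℕ
⟦ b ⟧ = if b then 1 else 0

⟦⟧-injective : ∀ {p q} → ⟦ p ⟧ ≡ ⟦ q ⟧ → p ≡ q
⟦⟧-injective {true} {true} _ = refl
⟦⟧-injective {false} {false} _ = refl

⟦⟧-cancelʳ : ∀ p q n → ⟦ p ⟧ + n ≡ ⟦ q ⟧ + n → p ≡ q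
⟦⟧-cancelʳ p q n e = ⟦⟧-injective (+-cancelʳ-≡ n ⟦ p ⟧ ⟦ q ⟧ e)

⟦⟧-one-less : ∀ p q n → ⟦ p ⟧ + n ≡ 1 → ⟦ q ⟧ + n ≡ 2 → p ≡ false × q ≡ true
⟦⟧-one-less false true _ _ _ = refl , refl
⟦⟧-one-less true _ (suc _) () _
⟦⟧-one-less true true zero _ ()
⟦⟧-one-less true false zero _ ()
⟦⟧-one-less false false (suc zero) _ ()
⟦⟧-one-less false false (suc (suc _)) () _
⟦⟧-one-less false false zero () _

≡ᵇ-refl : ∀ n → (n ≡ᵇ n) ≡ true
≡ᵇ-refl zero = refl
≡ᵇ-refl (suc n) = ≡ᵇ-refl n

≡ᵇ-true⇒≡ : ∀ m n → (m ≡ᵇ n) ≡ true → m ≡ n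
≡ᵇ-true⇒≡ zero zero _ = refl
≡ᵇ-true⇒≡ (suc m) (suc n) e = cong suc (≡ᵇ-true⇒≡ m n e)

≢⇒≡ᵇ-false : ∀ m n → ¬ m ≡ n → (m ≡ᵇ n) ≡ false
≢⇒≡ᵇ-false zero zero m≢n = ⊥-elim (m≢n refl)
≢⇒≡ᵇ-false zero (suc n) _ = refl
≢⇒≡ᵇ-false (suc m) zero _ = refl
≢⇒≡ᵇ-false (suc m) (suc n) m≢n = ≢⇒≡ᵇ-false m n (m≢n ∘ cong suc)

≢true⇒≡false : ∀ {b} → ¬ b ≡ true → b ≡ false
≢true⇒≡false {true} b≢true = ⊥-elim (b≢true refl)
≢true⇒≡false {false} _ = refl

∧-true⁻ : ∀ a b → a ∧ b ≡ true → a ≡ true × b ≡ true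
∧-true⁻ true true _ = refl , refl

∨-true⁻ : ∀ a b → a ∨ b ≡ true → a ≡ true ⊎ b ≡ true
∨-true⁻ true _ _ = inj₁ refl
∨-true⁻ false _ e = inj₂ e

≡⊎≡not : ∀ x y → y ≡ x ⊎ y ≡ not x
≡⊎≡not true true = inj₁ refl
≡⊎≡not true false = inj₂ refl
≡⊎≡not false true = inj₂ refl
≡⊎≡not false false = inj₁ refl

lastOf : ∀ {A : Set} → A → List A → A
lastOf x [] = x
lastOf x (y ∷ ys) = lastOf y ys

lastOf-++ : ∀ {A : Set} (x : A) xs y ys → lastOf x (xs ++ y ∷ ys) ≡ lastOf y ys
lastOf-++ x [] y ys = refl
lastOf-++ x (z ∷ xs) y ys = lastOf-++ z xs y ys

lastOf-∷ʳ : ∀ {A : Set} (x : A) xs Q z → x ∷ xs ≡ Q ∷ʳ z → lastOf x xs ≡ z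
lastOf-∷ʳ x [] [] z refl = refl
lastOf-∷ʳ x [] (_ ∷ []) z ()
lastOf-∷ʳ x [] (_ ∷ _ ∷ _) z ()
lastOf-∷ʳ x (y ∷ xs) (q ∷ Q) z e = lastOf-∷ʳ y xs Q z (∷-injectiveʳ e)

lastOf∈ : ∀ {A : Set} (x : A) xs → lastOf x xs ∈ x ∷ xs
lastOf∈ x [] = here refl
lastOf∈ x (y ∷ xs) = there (lastOf∈ y xs)

lastOf-applyUpTo : ∀ {A : Set} (f : ℕ → A) m → lastOf (f 0) (applyUpTo (f ∘ suc) m) ≡ f m
lastOf-applyUpTo f zero = refl
lastOf-applyUpTo f (suc m) = lastOf-applyUpTo (f ∘ suc) m

Unique-++⇒disjoint : ∀ {A : Set} (xs ys : List A) {x y} → Unique (xs ++ ys) → x ∈ xs → y ∈ ys → ¬ x ≡ y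
Unique-++⇒disjoint (a ∷ xs) ys (a∉ ∷ _) (here refl) y∈ys = All.lookup a∉ (∈-++⁺ʳ xs y∈ys)
Unique-++⇒disjoint (a ∷ xs) ys (_ ∷ u) (there x∈xs) y∈ys = Unique-++⇒disjoint xs ys u x∈xs y∈ys

Unique-++⁻ʳ : ∀ {A : Set} (xs : List A) {ys} → Unique (xs ++ ys) → Unique ys
Unique-++⁻ʳ [] u = u
Unique-++⁻ʳ (x ∷ xs) (_ ∷ u) = Unique-++⁻ʳ xs u

Unique-++⁻ˡ : ∀ {A : Set} (xs : List A) {ys} → Unique (xs ++ ys) → Unique xs
Unique-++⁻ˡ [] _ = []
Unique-++⁻ˡ (x ∷ xs) (x∉ ∷ u) = All.++⁻ˡ xs x∉ ∷ Unique-++⁻ˡ xs u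

Unique-∷-after : ∀ {A : Set} (xs : List A) v ys → Unique (xs ++ v ∷ ys) → v ∉ ys
Unique-∷-after xs v ys u v∈ys =
  Unique-++⇒disjoint (xs ∷ʳ v) ys (subst Unique (sym (++-assoc xs [ v ] ys)) u) (∈-++⁺ʳ xs (here refl)) v∈ys refl

Unique-∷-before : ∀ {A : Set} (xs : List A) v ys → Unique (xs ++ v ∷ ys) → v ∉ xs
Unique-∷-before xs v ys u v∈xs = Unique-++⇒disjoint xs (v ∷ ys) u v∈xs (here refl) refl

Linked-before : ∀ {A : Set} {R : A → A → Set} x xs v ys → Linked R ((x ∷ xs) ++ v ∷ ys) → R (lastOf x xs) v
Linked-before x [] v ys (r ∷ _) = r
Linked-before x (y ∷ xs) v ys (_ ∷ l) = Linked-before y xs v ys l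

Linked-after : ∀ {A : Set} {R : A → A → Set} xs v q ys → Linked R (xs ++ v ∷ q ∷ ys) → R v q
Linked-after [] v q ys (r ∷ _) = r
Linked-after (x ∷ []) v q ys (_ ∷ l) = Linked-after [] v q ys l
Linked-after (x ∷ y ∷ xs) v q ys (_ ∷ l) = Linked-after (y ∷ xs) v q ys l

Linked-join : ∀ {A : Set} {R : A → A → Set} x xs y ys → Linked R (x ∷ xs) → Linked R (y ∷ ys) → R (lastOf x xs) y →
              Linked R (x ∷ xs ++ y ∷ ys)
Linked-join x [] y ys _ l r = r ∷ l
Linked-join x (z ∷ xs) y ys (r′ ∷ l′) l r = r′ ∷ Linked-join z xs y ys l′ l r

Linked-overlap : ∀ {A : Set} {R : A → A → Set} Q z ys → Linked R (Q ∷ʳ z) → Linked R (z ∷ ys) → Linked R ((Q ∷ʳ z) ++ ys)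
Linked-overlap [] z ys _ l = l
Linked-overlap (q ∷ []) z ys (r ∷ _) l = r ∷ l
Linked-overlap (q ∷ q′ ∷ Q) z ys (r ∷ l′) l = r ∷ Linked-overlap (q′ ∷ Q) z ys l′ l

Linked-++⁻ˡ : ∀ {A : Set} {R : A → A → Set} xs {ys} → Linked R (xs ++ ys) → Linked R xs
Linked-++⁻ˡ [] _ = []
Linked-++⁻ˡ (x ∷ []) _ = [-]
Linked-++⁻ˡ (x ∷ x′ ∷ xs) (r ∷ l) = r ∷ Linked-++⁻ˡ (x′ ∷ xs) l

Linked-++⁻ʳ : ∀ {A : Set} {R : A → A → Set} xs {ys} → Linked R (xs ++ ys) → Linked R ys
Linked-++⁻ʳ [] l = l
Linked-++⁻ʳ (x ∷ xs) l = Linked-++⁻ʳ xs (Linked.tail l)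

Linked-junction : ∀ {A : Set} {R : A → A → Set} xs z y ys → Linked R ((xs ∷ʳ z) ++ y ∷ ys) → R z y
Linked-junction [] z y ys (r ∷ _) = r
Linked-junction (x ∷ xs) z y ys l = Linked-junction xs z y ys (Linked.tail l)

applyUpTo-cong : ∀ {A : Set} {f g : ℕ → A} m → (∀ t → f t ≡ g t) → applyUpTo f m ≡ applyUpTo g m
applyUpTo-cong zero _ = refl
applyUpTo-cong (suc m) f≗g = cong₂ _∷_ (f≗g 0) (applyUpTo-cong m (f≗g ∘ suc))

StartsAt-∷ʳ-++ : ∀ {v} xs z ys → StartsAt ((xs ∷ʳ z) ++ ys) v → StartsAt (xs ∷ʳ z) v
StartsAt-∷ʳ-++ [] z ys (_ , e) = [] , cong [_] (∷-injectiveˡ e)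
StartsAt-∷ʳ-++ (x ∷ xs) z ys (_ , e) = xs ∷ʳ z , cong (_∷ xs ∷ʳ z) (∷-injectiveˡ e)

EndsAt-suffix : ∀ {e} xs v ys → EndsAt (xs ++ v ∷ ys) e → EndsAt (v ∷ ys) e
EndsAt-suffix [] v ys ends = ends
EndsAt-suffix (x ∷ xs) v ys (q ∷ Q , e) = EndsAt-suffix xs v ys (Q , ∷-injectiveʳ e)
EndsAt-suffix (x ∷ []) v ys ([] , ())
EndsAt-suffix (x ∷ _ ∷ _) v ys ([] , ())

-- Column crossings of paths in the cylinder

data ColumnStep (j j′ : ℕ) : Set where
  stay  : j ≡ j′ → ColumnStep j j′
  right : suc j ≡ j′ → ColumnStep j j′
  left  : suc j′ ≡ j → ColumnStep j j′

module _ {r c : ℕ} where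

  adj⇒columnStep : ∀ {u v} → Adj r c u v → ColumnStep (col u) (col v)
  adj⇒columnStep (_ , _ , inj₁ (_ , inj₁ e)) = right e
  adj⇒columnStep (_ , _ , inj₁ (_ , inj₂ e)) = left e
  adj⇒columnStep (_ , _ , inj₂ (e , _)) = stay e

  adj-inRangeˡ : ∀ {u v} → Adj r c u v → InRange r c u
  adj-inRangeˡ (inU , _ , _) = inU

  adj-inRangeʳ : ∀ {u v} → Adj r c u v → InRange r c v
  adj-inRangeʳ (_ , inV , _) = inV

  adj-sym : ∀ {u v} → Adj r c u v → Adj r c v u
  adj-sym (inU , inV , inj₁ (e , inj₁ x)) = inV , inU , inj₁ (sym e , inj₂ x)
  adj-sym (inU , inV , inj₁ (e , inj₂ x)) = inV , inU , inj₁ (sym e , inj₁ x)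
  adj-sym (inU , inV , inj₂ (e , inj₁ x)) = inV , inU , inj₂ (sym e , inj₂ (inj₁ x))
  adj-sym (inU , inV , inj₂ (e , inj₂ (inj₁ x))) = inV , inU , inj₂ (sym e , inj₁ x)
  adj-sym (inU , inV , inj₂ (e , inj₂ (inj₂ (inj₁ x)))) = inV , inU , inj₂ (sym e , inj₂ (inj₂ (inj₂ x)))
  adj-sym (inU , inV , inj₂ (e , inj₂ (inj₂ (inj₂ x)))) = inV , inU , inj₂ (sym e , inj₂ (inj₂ (inj₁ x)))

isHj-right : ∀ j u v → col u ≡ j → col v ≡ suc j → isHj j u v ≡ true
isHj-right j u v refl refl rewrite ≡ᵇ-refl j = refl

isHj-left : ∀ j u v → col v ≡ j → col u ≡ suc j → isHj j u v ≡ true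
isHj-left j u v refl refl rewrite ≡ᵇ-refl j = ∨-zeroʳ _

hcount-∷-≤ : ∀ j x xs → hcount j xs ≤ hcount j (x ∷ xs)
hcount-∷-≤ j x [] = z≤n
hcount-∷-≤ j x (y ∷ ys) = m≤n+m _ _

hcount-++ʳ-≤ : ∀ j xs ys → hcount j ys ≤ hcount j (xs ++ ys)
hcount-++ʳ-≤ j [] ys = ≤-refl
hcount-++ʳ-≤ j (x ∷ xs) ys = ≤-trans (hcount-++ʳ-≤ j xs ys) (hcount-∷-≤ j x (xs ++ ys))

hcount-++ˡ-≤ : ∀ j xs ys → hcount j xs ≤ hcount j (xs ++ ys)
hcount-++ˡ-≤ j [] ys = z≤n
hcount-++ˡ-≤ j (x ∷ []) ys = z≤n
hcount-++ˡ-≤ j (x ∷ y ∷ xs) ys = +-monoʳ-≤ ⟦ isHj j x y ⟧ (hcount-++ˡ-≤ j (y ∷ xs) ys)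

_≤ᶜ_ : V → V → Set
u ≤ᶜ v = col u ≤ col v

record ColumnSplit (L : List V) : Set where
  constructor mkColumnSplit
  field
    low high : List V
    split : L ≡ low ++ high
    low≤1 : All (λ v → col v ≤ 1) low
    high≥2 : high ≡ [] ⊎ ∃[ y ] ∃[ R ] (high ≡ y ∷ R × 2 ≤ col y)

columnSplit : ∀ L → ColumnSplit L
columnSplit [] = mkColumnSplit [] [] refl [] (inj₁ refl)
columnSplit (x ∷ xs) with col x ≤? 1
... | no col≰1 = mkColumnSplit [] (x ∷ xs) refl [] (inj₂ (x , xs , refl , ≰⇒> col≰1))
... | yes col≤1 with columnSplit xs
...   | mkColumnSplit A Bs e A≤1 Bs≥2 = mkColumnSplit (x ∷ A) Bs (cong (x ∷_) e) (col≤1 ∷ A≤1) Bs≥2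

module _ {r c : ℕ} where

  uncrossed⇒staysRight : ∀ j y R → Linked (Adj r c) (y ∷ R) → suc j ≤ col y → hcount j (y ∷ R) ≡ 0 →
                         All (λ v → suc j ≤ col v) (y ∷ R)
  uncrossed⇒staysRight j y [] _ j<y _ = j<y ∷ []
  uncrossed⇒staysRight j y (z ∷ R) (yz ∷ l) j<y h with suc j ≤? col z
  ... | yes j<z = j<y ∷ uncrossed⇒staysRight j z R l j<z (m+n≡0⇒n≡0 ⟦ isHj j y z ⟧ h)
  ... | no j≮z with adj⇒columnStep yz
  ...   | stay e = ⊥-elim (j≮z (subst (suc j ≤_) e j<y))
  ...   | right e = ⊥-elim (j≮z (≤-trans j<y (subst (col y ≤_) e (n≤1+n _))))
  ...   | left e with ≤-antisym (≤-pred (subst (suc j ≤_) (sym e) j<y)) (≤-pred (≰⇒> j≮z))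
  ...     | refl with trans (cong (λ b → ⟦ b ⟧ + hcount (col z) (z ∷ R)) (sym (isHj-left (col z) y z refl (sym e)))) h
  ...       | ()

  -- Having crossed from column j to j + 1, the path may not cross back: each gap is crossed at most once.
  crossedOnce⇒columnMonotone :
    ∀ b x xs → Linked (Adj r c) (x ∷ xs) → All (λ v → b ≤ col v) (x ∷ xs) →
    (∀ j → b ≤ j → j < col x → hcount j (x ∷ xs) ≡ 0) →
    (∀ j → col x ≤ j → suc j < c → hcount j (x ∷ xs) ≤ 1) →
    Linked _≤ᶜ_ (x ∷ xs)
  crossedOnce⇒columnMonotone b x [] _ _ _ _ = [-]
  crossedOnce⇒columnMonotone b x (y ∷ ys) (xy ∷ l) (_ ∷ b≤ys) left0 right1 with adj⇒columnStep xy
  ... | stay e = subst (col x ≤_) e ≤-refl ∷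
        crossedOnce⇒columnMonotone b y ys l b≤ys
          (λ j b≤j j<y → n≤0⇒n≡0 (≤-trans (hcount-∷-≤ j x (y ∷ ys)) (≤-reflexive (left0 j b≤j (subst (j <_) (sym e) j<y)))))
          (λ j y≤j j<c → ≤-trans (hcount-∷-≤ j x (y ∷ ys)) (right1 j (subst (_≤ j) (sym e) y≤j) j<c))
  ... | right e = subst (col x ≤_) e (n≤1+n _) ∷
        crossedOnce⇒columnMonotone b y ys l b≤ys left0′
          (λ j y≤j j<c → ≤-trans (hcount-∷-≤ j x (y ∷ ys)) (right1 j (≤-trans (n≤1+n _) (subst (_≤ j) (sym e) y≤j)) j<c))
    where
    crossedHere : hcount (col x) (x ∷ y ∷ ys) ≡ suc (hcount (col x) (y ∷ ys))
    crossedHere = cong (λ b → ⟦ b ⟧ + hcount (col x) (y ∷ ys)) (isHj-right (col x) x y refl (sym e))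
    x<c : suc (col x) < c
    x<c = subst (_< c) (sym e) (proj₂ (adj-inRangeʳ xy))
    left0′ : ∀ j → b ≤ j → j < col y → hcount j (y ∷ ys) ≡ 0
    left0′ j b≤j j<y with m≤n⇒m<n∨m≡n (≤-pred (subst (suc j ≤_) (sym e) j<y))
    ... | inj₁ j<x = n≤0⇒n≡0 (≤-trans (hcount-∷-≤ j x (y ∷ ys)) (≤-reflexive (left0 j b≤j j<x)))
    ... | inj₂ refl = n≤0⇒n≡0 (≤-pred (subst (_≤ 1) crossedHere (right1 j ≤-refl x<c)))
  ... | left e = ⊥-elim (0≢1+n (trans (sym (left0 (col y) b≤y (subst (col y <_) e ≤-refl))) crossedHere))
    where
    b≤y : b ≤ col y
    b≤y = All.head b≤ys
    crossedHere : hcount (col y) (x ∷ y ∷ ys) ≡ suc (hcount (col y) (y ∷ ys))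
    crossedHere = cong (λ b → ⟦ b ⟧ + hcount (col y) (y ∷ ys)) (isHj-left (col y) x y refl (sym e))

  hTotal-columnMonotone : ∀ x xs → Linked (Adj r c) (x ∷ xs) → Linked _≤ᶜ_ (x ∷ xs) →
                          hTotal (x ∷ xs) + col x ≡ col (lastOf x xs)
  hTotal-columnMonotone x [] _ _ = refl
  hTotal-columnMonotone x (y ∷ ys) (xy ∷ l) (x≤y ∷ l′) with adj⇒columnStep xy
  ... | stay e rewrite e | ≡ᵇ-refl (col y) = hTotal-columnMonotone y ys l l′
  ... | right e rewrite sym e | ≢⇒≡ᵇ-false (col x) (suc (col x)) (λ q → 1+n≢n (sym q)) =
        trans (sym (+-suc (hTotal (y ∷ ys)) (col x)))
              (subst (λ z → hTotal (y ∷ ys) + z ≡ col (lastOf y ys)) (sym e) (hTotal-columnMonotone y ys l l′))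
  ... | left e = ⊥-elim (1+n≰n (subst (_≤ col y) (sym e) x≤y))

-- Degrees along a path

eqV : V → V → Bool
eqV (i , j) (i′ , j′) = (i ≡ᵇ i′) ∧ (j ≡ᵇ j′)

eqV-true⇒≡ : ∀ u v → eqV u v ≡ true → u ≡ v
eqV-true⇒≡ (i , j) (i′ , j′) e =
  let p , q = ∧-true⁻ _ _ e in cong₂ _,_ (≡ᵇ-true⇒≡ i i′ p) (≡ᵇ-true⇒≡ j j′ q)

eqV-refl : ∀ v → eqV v v ≡ true
eqV-refl (i , j) rewrite ≡ᵇ-refl i | ≡ᵇ-refl j = refl

≢⇒eqV-false : ∀ u v → ¬ u ≡ v → eqV u v ≡ false
≢⇒eqV-false u v u≢v = ≢true⇒≡false (u≢v ∘ eqV-true⇒≡ u v)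

isEdge : V → V → V → V → Bool
isEdge u v x y = (eqV u x ∧ eqV v y) ∨ (eqV u y ∧ eqV v x)

isEdge-true⇒ : ∀ u v x y → isEdge u v x y ≡ true → (u ≡ x × v ≡ y) ⊎ (u ≡ y × v ≡ x)
isEdge-true⇒ u v x y e with ∨-true⁻ (eqV u x ∧ eqV v y) _ e
... | inj₁ e′ = let p , q = ∧-true⁻ (eqV u x) _ e′ in inj₁ (eqV-true⇒≡ u x p , eqV-true⇒≡ v y q)
... | inj₂ e′ = let p , q = ∧-true⁻ (eqV u y) _ e′ in inj₂ (eqV-true⇒≡ u y p , eqV-true⇒≡ v x q)

isEdge-away : ∀ u v x y → eqV u x ≡ false → eqV v x ≡ false → isEdge u v x y ≡ false
isEdge-away u v x y p q rewrite p | q = ∧-zeroʳ (eqV u y)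

isEdge-atSecond : ∀ u v x y → eqV u x ≡ false → eqV v x ≡ true → isEdge u v x y ≡ eqV u y
isEdge-atSecond u v x y p q rewrite p | q = ∧-identityʳ (eqV u y)

isEdge-atFirst : ∀ u v x y → eqV u x ≡ true → eqV u y ≡ false → isEdge u v x y ≡ eqV v y
isEdge-atFirst u v x y p q rewrite p | q = ∨-identityʳ (eqV v y)

consecutive : List V → V → V → Bool
consecutive [] x y = false
consecutive (u ∷ []) x y = false
consecutive (u ∷ v ∷ L) x y = isEdge u v x y ∨ consecutive (v ∷ L) x y

consecutive-sym : ∀ L x y → consecutive L x y ≡ consecutive L y x
consecutive-sym [] x y = refl
consecutive-sym (u ∷ []) x y = refl
consecutive-sym (u ∷ v ∷ L) x y = cong₂ _∨_ (∨-comm (eqV u x ∧ eqV v y) _) (consecutive-sym (v ∷ L) x y)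

consecutive⇒∈ : ∀ L x y → consecutive L x y ≡ true → x ∈ L
consecutive⇒∈ (u ∷ v ∷ L) x y e = [ edgeHere ∘ isEdge-true⇒ u v x y , there ∘ consecutive⇒∈ (v ∷ L) x y ]′ (∨-true⁻ _ _ e)
  where
  edgeHere : (u ≡ x × v ≡ y) ⊎ (u ≡ y × v ≡ x) → x ∈ u ∷ v ∷ L
  edgeHere (inj₁ (refl , _)) = here refl
  edgeHere (inj₂ (_ , refl)) = there (here refl)

∉⇒¬consecutive : ∀ L x y → x ∉ L → consecutive L x y ≡ false
∉⇒¬consecutive L x y x∉L = ≢true⇒≡false (x∉L ∘ consecutive⇒∈ L x y)

isLast isHead : List V → V → Bool
isLast [] n = false
isLast (a ∷ A) n = eqV (lastOf a A) n
isHead [] n = false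
isHead (q ∷ _) n = eqV q n

consecutive-around : ∀ A Bs v n → v ∉ A → v ∉ Bs → ¬ n ≡ v →
                     consecutive (A ++ v ∷ Bs) v n ≡ isLast A n ∨ isHead Bs n
consecutive-around [] [] v n _ _ _ = refl
consecutive-around [] (q ∷ Bs) v n _ v∉Bs n≢v =
  trans (cong₂ _∨_ (isEdge-atFirst v q v n (eqV-refl v) (≢⇒eqV-false v n (n≢v ∘ sym)))
                   (∉⇒¬consecutive (q ∷ Bs) v n v∉Bs))
        (∨-identityʳ (eqV q n))
consecutive-around (p ∷ []) Bs v n v∉A v∉Bs n≢v =
  cong₂ _∨_ (isEdge-atSecond p v v n (≢⇒eqV-false p v (v∉A ∘ here ∘ sym)) (eqV-refl v))
            (consecutive-around [] Bs v n (λ ()) v∉Bs n≢v)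
consecutive-around (p ∷ p′ ∷ A) Bs v n v∉A v∉Bs n≢v =
  cong₂ _∨_ (isEdge-away p p′ v n (≢⇒eqV-false p v (v∉A ∘ here ∘ sym)) (≢⇒eqV-false p′ v (v∉A ∘ there ∘ here ∘ sym)))
            (consecutive-around (p′ ∷ A) Bs v n (v∉A ∘ there) v∉Bs n≢v)

countTrue : (V → Bool) → List V → ℕ
countTrue f [] = 0
countTrue f (n ∷ N) = ⟦ f n ⟧ + countTrue f N

countTrue-cong : ∀ f g N → (∀ n → n ∈ N → f n ≡ g n) → countTrue f N ≡ countTrue g N
countTrue-cong f g [] _ = refl
countTrue-cong f g (n ∷ N) f≗g = cong₂ _+_ (cong ⟦_⟧ (f≗g n (here refl))) (countTrue-cong f g N (λ m m∈N → f≗g m (there m∈N)))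

countTrue-∨ : ∀ f g N → (∀ n → f n ≡ true → g n ≡ true → ⊥) →
              countTrue (λ n → f n ∨ g n) N ≡ countTrue f N + countTrue g N
countTrue-∨ f g [] _ = refl
countTrue-∨ f g (n ∷ N) disj = begin
  ⟦ f n ∨ g n ⟧ + countTrue (λ n → f n ∨ g n) N    ≡⟨ cong₂ _+_ (⟦∨⟧ (f n) (g n) (disj n)) (countTrue-∨ f g N disj) ⟩
  (⟦ f n ⟧ + ⟦ g n ⟧) + (countTrue f N + countTrue g N) ≡⟨ interchange ⟦ f n ⟧ ⟦ g n ⟧ _ _ ⟩
  (⟦ f n ⟧ + countTrue f N) + (⟦ g n ⟧ + countTrue g N) ∎
  where
  open ≡-Reasoning
  ⟦∨⟧ : ∀ a b → (a ≡ true → b ≡ true → ⊥) → ⟦ a ∨ b ⟧ ≡ ⟦ a ⟧ + ⟦ b ⟧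
  ⟦∨⟧ true true both = ⊥-elim (both refl refl)
  ⟦∨⟧ true false _ = refl
  ⟦∨⟧ false b _ = refl

countTrue-false : ∀ N → countTrue (λ _ → false) N ≡ 0
countTrue-false [] = refl
countTrue-false (n ∷ N) = countTrue-false N

countTrue-eqV : ∀ p N → p ∈ N → Unique N → countTrue (eqV p) N ≡ 1
countTrue-eqV p (n ∷ N) (here refl) (p∉N ∷ _) rewrite eqV-refl p =
  cong suc (trans (countTrue-cong (eqV p) (λ _ → false) N (λ m m∈N → ≢⇒eqV-false p m (All.lookup p∉N m∈N))) (countTrue-false N))
countTrue-eqV p (n ∷ N) (there p∈N) (n∉N ∷ u) rewrite ≢⇒eqV-false p n (λ e → All.lookup n∉N (subst (_∈ N) e p∈N) refl) =
  countTrue-eqV p N p∈N u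

isLast⇒∈ : ∀ A n → isLast A n ≡ true → n ∈ A
isLast⇒∈ (a ∷ A) n e = subst (_∈ a ∷ A) (eqV-true⇒≡ _ _ e) (lastOf∈ a A)

isHead⇒∈ : ∀ Bs n → isHead Bs n ≡ true → n ∈ Bs
isHead⇒∈ (q ∷ Bs) n e = here (sym (eqV-true⇒≡ q n e))

degree : ∀ {R : V → V → Set} A Bs v N →
         Unique (A ++ v ∷ Bs) → Linked R (A ++ v ∷ Bs) →
         (∀ w → R w v → w ∈ N) → (∀ w → R v w → w ∈ N) → Unique N → v ∉ N →
         countTrue (consecutive (A ++ v ∷ Bs) v) N ≡ ⟦ not (null A) ⟧ + ⟦ not (null Bs) ⟧
degree {R} A Bs v N u l before∈N after∈N uN v∉N = begin
  countTrue (consecutive (A ++ v ∷ Bs) v) N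
    ≡⟨ countTrue-cong _ _ N (λ n n∈N → consecutive-around A Bs v n (Unique-∷-before A v Bs u) (Unique-∷-after A v Bs u)
                                         (λ n≡v → v∉N (subst (_∈ N) n≡v n∈N))) ⟩
  countTrue (λ n → isLast A n ∨ isHead Bs n) N
    ≡⟨ countTrue-∨ (isLast A) (isHead Bs) N
         (λ n p q → Unique-++⇒disjoint A (v ∷ Bs) u (isLast⇒∈ A n p) (there (isHead⇒∈ Bs n q)) refl) ⟩
  countTrue (isLast A) N + countTrue (isHead Bs) N
    ≡⟨ cong₂ _+_ (lastCount A l) (headCount Bs l) ⟩
  ⟦ not (null A) ⟧ + ⟦ not (null Bs) ⟧ ∎
  where
  open ≡-Reasoning
  lastCount : ∀ A → Linked R (A ++ v ∷ Bs) → countTrue (isLast A) N ≡ ⟦ not (null A) ⟧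
  lastCount [] _ = countTrue-false N
  lastCount (a ∷ A) l = countTrue-eqV (lastOf a A) N (before∈N _ (Linked-before a A v Bs l)) uN
  headCount : ∀ Bs → Linked R (A ++ v ∷ Bs) → countTrue (isHead Bs) N ≡ ⟦ not (null Bs) ⟧
  headCount [] _ = countTrue-false N
  headCount (q ∷ Bs) l = countTrue-eqV q N (after∈N _ (Linked-after A v q Bs l)) uN

-- Degree equations on a ladder

-- Definitionally countTrue over a three-element list, hence the trailing + 0.
deg₃ : Bool → Bool → Bool → ℕ
deg₃ x y z = ⟦ x ⟧ + (⟦ y ⟧ + (⟦ z ⟧ + 0))

deg₃-cancel₂ : ∀ x y y′ z → deg₃ x y z ≡ deg₃ x y′ z → y ≡ y′
deg₃-cancel₂ x y y′ z e = ⟦⟧-cancelʳ y y′ (⟦ z ⟧ + 0) (+-cancelˡ-≡ ⟦ x ⟧ _ _ e)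

deg₃-swap : ∀ x y z → deg₃ x y z ≡ deg₃ y x z
deg₃-swap true true z = refl
deg₃-swap true false z = refl
deg₃-swap false true z = refl
deg₃-swap false false z = refl

deg₃-oneLess : ∀ p q y z → deg₃ p y z ≡ 1 → deg₃ q y z ≡ 2 → p ≡ false × q ≡ true
deg₃-oneLess p q y z = ⟦⟧-one-less p q (⟦ y ⟧ + (⟦ z ⟧ + 0))

deg₃-flip : ∀ x y y′ z → deg₃ x y z ≡ 2 → deg₃ (not x) y′ z ≡ 2 → y′ ≡ not y × y ≡ not x × z ≡ true
deg₃-flip true true y′ true () _
deg₃-flip true true true false _ ()
deg₃-flip true true false false _ ()
deg₃-flip true false true true _ _ = refl , refl , refl
deg₃-flip true false false true _ ()
deg₃-flip true false y′ false () _
deg₃-flip false true false true _ _ = refl , refl , refl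
deg₃-flip false true true true _ ()
deg₃-flip false true y′ false () _
deg₃-flip false false y′ true () _
deg₃-flip false false y′ false () _

deg₃-flipEnd : ∀ x y y′ z → deg₃ x y z ≡ 2 → deg₃ (not x) y′ z ≡ 1 → x ≡ true × y ≡ y′
deg₃-flipEnd true true true false _ _ = refl , refl
deg₃-flipEnd true true false false _ ()
deg₃-flipEnd true true y′ true () _
deg₃-flipEnd true false false true _ _ = refl , refl
deg₃-flipEnd true false true true _ ()
deg₃-flipEnd true false y′ false () _
deg₃-flipEnd false true true true _ ()
deg₃-flipEnd false true false true _ ()
deg₃-flipEnd false true y′ false () _
deg₃-flipEnd false false y′ true () _
deg₃-flipEnd false false y′ false () _

flips : ℕ → Bool → Bool
flips zero b = b
flips (suc d) b = not (flips d b)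

flips-parity : ∀ d b → (flips d b ≡ b × ∃[ t ] d ≡ 2 * t) ⊎ (flips d b ≡ not b × ∃[ t ] d ≡ 2 * t + 1)
flips-parity zero b = inj₁ (refl , 0 , refl)
flips-parity (suc d) b with flips-parity d b
... | inj₁ (e , t , refl) = inj₂ (cong not e , t , +-comm 1 (2 * t))
... | inj₂ (e , t , refl) = inj₁ (trans (cong not e) (not-involutive b) , suc t , cong suc (trans (+-comm (2 * t) 1) (sym (+-suc t (t + 0)))))

flips-odd : ∀ d b → flips d b ≡ not b → ∃[ t ] d ≡ 2 * t + 1
flips-odd d b e with flips-parity d b
... | inj₂ (_ , odd) = odd
... | inj₁ (e′ , _) = ⊥-elim (b≢not b (trans (sym e′) e))
  where
  b≢not : ∀ b → ¬ b ≡ not b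
  b≢not true ()
  b≢not false ()

-- Two columns of a ladder, with u i and v i indicating the vertical edge from row i to row i + 1
-- in each column and s i the rung in row i.
module Ladder (u v s : ℕ → Bool) where

  Inner : ℕ → ℕ → Set
  Inner lo d = ∀ t → t < d → deg₃ (u (lo + t)) (u (suc (lo + t))) (s (suc (lo + t))) ≡ 2
                           × deg₃ (v (lo + t)) (v (suc (lo + t))) (s (suc (lo + t))) ≡ 2

  Inner-pred : ∀ {lo d} → Inner lo (suc d) → Inner lo d
  Inner-pred h t t<d = h t (m≤n⇒m≤1+n t<d)

  propagate-≡ : ∀ lo d → Inner lo d → u lo ≡ v lo → u (lo + d) ≡ v (lo + d)
  propagate-≡ lo zero _ e rewrite +-identityʳ lo = e
  propagate-≡ lo (suc d) h e rewrite +-suc lo d =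
    let hu , hv = h d ≤-refl
        ud≡vd = propagate-≡ lo d (Inner-pred h) e
    in deg₃-cancel₂ (u (lo + d)) _ _ _ (trans hu (sym (subst (λ b → deg₃ b (v (suc (lo + d))) (s (suc (lo + d))) ≡ 2) (sym ud≡vd) hv)))

  propagate-≢ : ∀ lo d → Inner lo d → v lo ≡ not (u lo) →
                v (lo + d) ≡ not (u (lo + d)) × u (lo + d) ≡ flips d (u lo) × (∀ t → t < d → s (suc (lo + t)) ≡ true)
  propagate-≢ lo zero _ e rewrite +-identityʳ lo = e , refl , (λ _ ())
  propagate-≢ lo (suc d) h e with propagate-≢ lo d (Inner-pred h) e
  ... | vd≡¬ud , ud≡flips , rungs with h d ≤-refl
  ...   | hu , hv with deg₃-flip (u (lo + d)) _ _ _ hu (subst (λ b → deg₃ b (v (suc (lo + d))) (s (suc (lo + d))) ≡ 2) vd≡¬ud hv)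
  ...     | v′≡¬u′ , u′≡¬ud , rung rewrite +-suc lo d = v′≡¬u′ , trans u′≡¬ud (cong not ud≡flips) , rungs′
    where
    rungs′ : ∀ t → t < suc d → s (suc (lo + t)) ≡ true
    rungs′ t t<sd with m≤n⇒m<n∨m≡n (≤-pred t<sd)
    ... | inj₁ t<d = rungs t t<d
    ... | inj₂ refl = rung

  -- The ladder has r = a + d + 1 rows and its Hamiltonian path runs from (0 , 0) to (a , 1), a = a′ + 1.
  module _ (a′ d : ℕ) where

    private
      a r : ℕ
      a = suc a′
      r = suc (a + d)

      a′<r : suc a′ < r
      a′<r = s≤s (s≤s (m≤m+n a′ d))

      below : (∀ i → suc i < r → deg₃ (u i) (u (suc i)) (s (suc i)) ≡ 2) →
              (∀ i → suc i < r → ¬ suc i ≡ a → deg₃ (v i) (v (suc i)) (s (suc i)) ≡ 2) → Inner 0 a′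
      below inner₀ inner₁ t t<a′ = inner₀ t t<r , inner₁ t t<r (λ e → <-irrefl (suc-injective e) t<a′)
        where
        t<r : suc t < r
        t<r = s≤s (s≤s (≤-trans (<⇒≤ t<a′) (m≤m+n a′ d)))

      above : (∀ i → suc i < r → deg₃ (u i) (u (suc i)) (s (suc i)) ≡ 2) →
              (∀ i → suc i < r → ¬ suc i ≡ a → deg₃ (v i) (v (suc i)) (s (suc i)) ≡ 2) → Inner a d
      above inner₀ inner₁ t t<d = inner₀ (a + t) t<r , inner₁ (a + t) t<r (λ e → <-irrefl (sym e) (s≤s (m≤m+n a t)))
        where
        t<r : suc (a + t) < r
        t<r = s≤s (+-monoʳ-< a t<d)

    endpointDichotomy :
      (∀ i → suc i < r → deg₃ (u i) (u (suc i)) (s (suc i)) ≡ 2) →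
      (∀ i → suc i < r → ¬ suc i ≡ a → deg₃ (v i) (v (suc i)) (s (suc i)) ≡ 2) →
      deg₃ (v a′) (v a) (s a) ≡ 1 →
      deg₃ (u (a + d)) (u 0) (s 0) ≡ 1 →
      deg₃ (v (a + d)) (v 0) (s 0) ≡ 2 →
      (∃[ k ] a′ ≡ 2 * k + 1 × (∀ t → t < 2 * k + 1 → s (suc t) ≡ true))
      ⊎ (∃[ k ] d ≡ 2 * k + 1 × (∀ t → t < 2 * k + 1 → s (suc (a + t)) ≡ true))
    endpointDichotomy inner₀ inner₁ end₁ start₀ start₁ with ≡⊎≡not (u 0) (v 0)
    ... | inj₂ v0≡¬u0
      with propagate-≢ 0 a′ (below inner₀ inner₁) v0≡¬u0
    ... | va′≡¬ua′ , ua′≡flips , rungs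
      with deg₃-flipEnd (u a′) (u a) (v a) (s a) (inner₀ a′ a′<r) (subst (λ b → deg₃ b (v a) (s a) ≡ 1) va′≡¬ua′ end₁)
    ... | ua′≡true , ua≡va
      with deg₃-oneLess (u 0) (v 0) (u (a + d)) (s 0) (trans (deg₃-swap (u 0) (u (a + d)) (s 0)) start₀)
             (trans (deg₃-swap (v 0) (u (a + d)) (s 0))
                    (subst (λ b → deg₃ b (v 0) (s 0) ≡ 2) (sym (propagate-≡ a d (above inner₀ inner₁) ua≡va)) start₁))
    ... | u0≡false , _
      with flips-odd a′ (u 0) (trans (sym ua′≡flips) (trans ua′≡true (sym (cong not u0≡false))))
    ... | k , a′≡2k+1 = inj₁ (k , a′≡2k+1 , λ t t<2k+1 → rungs t (subst (t <_) (sym a′≡2k+1) t<2k+1))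
    endpointDichotomy inner₀ inner₁ end₁ start₀ start₁ | inj₁ v0≡u0
      with propagate-≡ 0 a′ (below inner₀ inner₁) (sym v0≡u0)
    ... | ua′≡va′
      with deg₃-oneLess (v a) (u a) (u a′) (s a)
             (trans (deg₃-swap (v a) (u a′) (s a)) (subst (λ b → deg₃ b (v a) (s a) ≡ 1) (sym ua′≡va′) end₁))
             (trans (deg₃-swap (u a) (u a′) (s a)) (inner₀ a′ a′<r))
    ... | va≡false , ua≡true
      with propagate-≢ a d (above inner₀ inner₁) (trans va≡false (sym (cong not ua≡true)))
    ... | _ , ur≡flips , rungs
      with deg₃-oneLess (u (a + d)) (v (a + d)) (u 0) (s 0) start₀ (subst (λ b → deg₃ (v (a + d)) b (s 0) ≡ 2) v0≡u0 start₁)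
    ... | ur≡false , _
      with flips-odd d (u a) (trans (sym ur≡flips) (trans ur≡false (sym (cong not ua≡true))))
    ... | k , d≡2k+1 = inj₂ (k , d≡2k+1 , λ t t<2k+1 → rungs t (subst (t <_) (sym d≡2k+1) t<2k+1))

-- Hamiltonian paths of the first two columns

wrap-< : ∀ {r a} → a < r → wrap r a ≡ a
wrap-< {r} {a} a<r rewrite ≢⇒≡ᵇ-false a r (<⇒≢ a<r) = refl

wrap-self : ∀ r → wrap r r ≡ 0
wrap-self r rewrite ≡ᵇ-refl r = refl

nextRow prevRow : ℕ → ℕ → ℕ
nextRow r i = wrap r (suc i)
prevRow r zero = r ∸ 1
prevRow r (suc i) = i

nextRow-cases : ∀ {r i} → i < r → (suc i < r × nextRow r i ≡ suc i) ⊎ (suc i ≡ r × nextRow r i ≡ 0)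
nextRow-cases {r} {i} i<r with m≤n⇒m<n∨m≡n i<r
... | inj₁ i+1<r = inj₁ (i+1<r , wrap-< i+1<r)
... | inj₂ i+1≡r = inj₂ (i+1≡r , trans (cong (wrap r) i+1≡r) (wrap-self r))

nextRow-prevRow : ∀ {r i} → i < r → nextRow r (prevRow r i) ≡ i
nextRow-prevRow {r} {zero} 0<r = trans (cong (wrap r) (m+[n∸m]≡n 0<r)) (wrap-self r)
nextRow-prevRow {r} {suc i} i<r = wrap-< i<r

neighbours : ℕ → ℕ → ℕ → List V
neighbours r i j = (prevRow r i , j) ∷ (nextRow r i , j) ∷ (i , 1 ∸ j) ∷ []

neighbours-complete : ∀ {r c i j w} → j ≤ 1 → col w ≤ 1 → Adj r c (i , j) w → w ∈ neighbours r i j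
neighbours-complete {j = zero} _ _ (_ , _ , inj₁ (refl , inj₁ refl)) = there (there (here refl))
neighbours-complete {j = suc _} _ (s≤s ()) (_ , _ , inj₁ (refl , inj₁ refl))
neighbours-complete {w = _ , zero} _ _ (_ , _ , inj₁ (refl , inj₂ refl)) = there (there (here refl))
neighbours-complete {w = _ , suc _} (s≤s ()) _ (_ , _ , inj₁ (refl , inj₂ refl))
neighbours-complete _ _ (_ , (i+1<r , _) , inj₂ (refl , inj₁ refl)) = there (here (cong (_, _) (sym (wrap-< i+1<r))))
neighbours-complete _ _ (_ , _ , inj₂ (refl , inj₂ (inj₁ refl))) = here refl
neighbours-complete _ _ (_ , _ , inj₂ (refl , inj₂ (inj₂ (inj₁ (refl , i′+1≡r))))) = here (cong (_, _) (cong (_∸ 1) i′+1≡r))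
neighbours-complete {r} _ _ (_ , _ , inj₂ (refl , inj₂ (inj₂ (inj₂ (refl , i+1≡r))))) =
  there (here (cong (_, _) (sym (trans (cong (wrap r) i+1≡r) (wrap-self r)))))

j≢1∸j : ∀ {j} → j ≤ 1 → ¬ j ≡ 1 ∸ j
j≢1∸j {zero} _ ()
j≢1∸j {suc zero} _ ()
j≢1∸j {suc (suc _)} (s≤s ()) _

prevRow≢self : ∀ {r i} → 2 ≤ r → ¬ prevRow r i ≡ i
prevRow≢self {r} {zero} 2≤r e = <⇒≢ (m<n⇒0<n∸m 2≤r) (sym e)
prevRow≢self {r} {suc i} _ = 1+n≢n ∘ sym

nextRow≢self : ∀ {r i} → 2 ≤ r → i < r → ¬ nextRow r i ≡ i
nextRow≢self {r} {i} 2≤r i<r with nextRow-cases i<r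
... | inj₁ (_ , next≡i+1) = 1+n≢n ∘ trans (sym next≡i+1)
... | inj₂ (i+1≡r , next≡0) = λ e → <⇒≢ (≤-trans (s≤s z≤n) (≤-pred (subst (2 ≤_) (sym i+1≡r) 2≤r))) (trans (sym next≡0) e)

prevRow≢nextRow : ∀ {r i} → 3 ≤ r → i < r → ¬ prevRow r i ≡ nextRow r i
prevRow≢nextRow {r} {zero} 3≤r 0<r e with nextRow-cases 0<r
... | inj₁ (_ , next≡1) = <⇒≢ (∸-monoˡ-< {2} {1} {r} 3≤r (s≤s z≤n)) (sym (trans e next≡1))
... | inj₂ (1≡r , _) = <⇒≢ (≤-trans (s≤s (s≤s z≤n)) 3≤r) 1≡r
prevRow≢nextRow {r} {suc i} 3≤r i+1<r e with nextRow-cases i+1<r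
... | inj₁ (_ , next≡i+2) = <⇒≢ (m<n⇒m<1+n (n<1+n i)) (trans e next≡i+2)
... | inj₂ (i+2≡r , next≡0) = <⇒≢ (≤-pred (≤-pred (subst (3 ≤_) (sym i+2≡r) 3≤r))) (sym (trans e next≡0))

neighbours-unique : ∀ {r i j} → 3 ≤ r → i < r → j ≤ 1 → Unique (neighbours r i j)
neighbours-unique 3≤r i<r j≤1 =
  (prevRow≢nextRow 3≤r i<r ∘ ,-injectiveˡ ∷ j≢1∸j j≤1 ∘ ,-injectiveʳ ∷ []) ∷ (j≢1∸j j≤1 ∘ ,-injectiveʳ ∷ []) ∷ [] ∷ []

∉neighbours : ∀ {r i j} → 2 ≤ r → i < r → j ≤ 1 → (i , j) ∉ neighbours r i j
∉neighbours 2≤r i<r j≤1 (here e) = prevRow≢self 2≤r (sym (,-injectiveˡ e))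
∉neighbours 2≤r i<r j≤1 (there (here e)) = nextRow≢self 2≤r i<r (sym (,-injectiveˡ e))
∉neighbours 2≤r i<r j≤1 (there (there (here e))) = j≢1∸j j≤1 (,-injectiveʳ e)

start⇒nothingBefore : ∀ {x} A v Bs → StartsAt (A ++ v ∷ Bs) x → Unique (A ++ v ∷ Bs) → v ≡ x → ⟦ not (null A) ⟧ ≡ 0
start⇒nothingBefore [] _ _ _ _ _ = refl
start⇒nothingBefore (a ∷ A) v Bs (_ , e) (a∉ ∷ _) refl = ⊥-elim (All.lookup a∉ (∈-++⁺ʳ A (here refl)) (∷-injectiveˡ e))

¬start⇒somethingBefore : ∀ {x} A v Bs → StartsAt (A ++ v ∷ Bs) x → ¬ v ≡ x → ⟦ not (null A) ⟧ ≡ 1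
¬start⇒somethingBefore [] v Bs (_ , e) v≢x = ⊥-elim (v≢x (∷-injectiveˡ e))
¬start⇒somethingBefore (_ ∷ _) _ _ _ _ = refl

end⇒nothingAfter : ∀ {x} A v Bs → EndsAt (A ++ v ∷ Bs) x → Unique (A ++ v ∷ Bs) → v ≡ x → ⟦ not (null Bs) ⟧ ≡ 0
end⇒nothingAfter A v Bs (Q , e) u refl with initLast Bs
... | [] = refl
... | B ∷ʳ′ z = ⊥-elim (Unique-∷-after A v (B ∷ʳ z) u (subst (_∈ B ∷ʳ z) z≡v (∈-++⁺ʳ B (here refl))))
  where
  z≡v : z ≡ v
  z≡v = ∷ʳ-injectiveʳ (A ++ v ∷ B) Q (trans (++-assoc A (v ∷ B) [ z ]) e)

¬end⇒somethingAfter : ∀ {x} A v Bs → EndsAt (A ++ v ∷ Bs) x → ¬ v ≡ x → ⟦ not (null Bs) ⟧ ≡ 1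
¬end⇒somethingAfter A v [] (Q , e) v≢x = ⊥-elim (v≢x (∷ʳ-injectiveʳ A Q e))
¬end⇒somethingAfter A v (_ ∷ _) _ _ = refl

record TwoColumnPath (r c : ℕ) (L : List V) (a : ℕ) : Set where
  field
    unique : Unique L
    linked : Linked (Adj r c) L
    columns≤1 : All (λ v → col v ≤ 1) L
    starts : StartsAt L (0 , 0)
    ends : EndsAt L (a , 1)
    covers : ∀ i j → i < r → j ≤ 1 → (i , j) ∈ L
    a<r : a < r

module TwoColumns {r c L a} (P : TwoColumnPath r c L a) where
  open TwoColumnPath P

  private
    Near : V → V → Set
    Near x y = Adj r c x y × col x ≤ 1 × col y ≤ 1

    near : ∀ {xs} → Linked (Adj r c) xs → All (λ v → col v ≤ 1) xs → Linked Near xs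
    near [] _ = []
    near [-] _ = [-]
    near (xy ∷ l) (x≤1 ∷ y≤1 ∷ ≤1) = (xy , x≤1 , y≤1) ∷ near l (y≤1 ∷ ≤1)

  degreeIn : ∀ v N → v ∈ L → Unique N → v ∉ N → (∀ w → Adj r c v w → col w ≤ 1 → w ∈ N) →
             ∃₂ λ A Bs → L ≡ A ++ v ∷ Bs × countTrue (consecutive L v) N ≡ ⟦ not (null A) ⟧ + ⟦ not (null Bs) ⟧
  degreeIn v N v∈L uN v∉N nbrs∈N with ∈-∃++ v∈L
  ... | A , Bs , refl = A , Bs , refl ,
        degree A Bs v N unique (near linked columns≤1)
          (λ w (wv , w≤1 , _) → nbrs∈N w (adj-sym wv) w≤1) (λ w (vw , _ , w≤1) → nbrs∈N w vw w≤1) uN v∉N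

  module _ {v N} (v∈L : v ∈ L) (uN : Unique N) (v∉N : v ∉ N) (nbrs∈N : ∀ w → Adj r c v w → col w ≤ 1 → w ∈ N) where

    degree-inner : ¬ v ≡ (0 , 0) → ¬ v ≡ (a , 1) → countTrue (consecutive L v) N ≡ 2
    degree-inner ≢start ≢end with degreeIn v N v∈L uN v∉N nbrs∈N
    ... | A , Bs , refl , deg =
      trans deg (cong₂ _+_ (¬start⇒somethingBefore A v Bs starts ≢start) (¬end⇒somethingAfter A v Bs ends ≢end))

    degree-start : v ≡ (0 , 0) → ¬ v ≡ (a , 1) → countTrue (consecutive L v) N ≡ 1
    degree-start ≡start ≢end with degreeIn v N v∈L uN v∉N nbrs∈N
    ... | A , Bs , refl , deg =
      trans deg (cong₂ _+_ (start⇒nothingBefore A v Bs starts unique ≡start) (¬end⇒somethingAfter A v Bs ends ≢end))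

    degree-end : ¬ v ≡ (0 , 0) → v ≡ (a , 1) → countTrue (consecutive L v) N ≡ 1
    degree-end ≢start ≡end with degreeIn v N v∈L uN v∉N nbrs∈N
    ... | A , Bs , refl , deg =
      trans deg (cong₂ _+_ (¬start⇒somethingBefore A v Bs starts ≢start) (end⇒nothingAfter A v Bs ends unique ≡end))

  edge : ℕ → ℕ → Bool
  edge j i = consecutive L (i , j) (nextRow r i , j)

  rung : ℕ → Bool
  rung i = consecutive L (i , 0) (i , 1)

  ladderDegree : ∀ {i} j → i < r → j ≤ 1 →
                 countTrue (consecutive L (i , j)) (neighbours r i j) ≡ deg₃ (edge j (prevRow r i)) (edge j i) (rung i)
  ladderDegree {i} j i<r j≤1 = cong₂ _+_ (cong ⟦_⟧ fromPrev) (cong (λ b → ⟦ edge j i ⟧ + (⟦ b ⟧ + 0)) (rungAt j≤1))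
    where
    fromPrev : consecutive L (i , j) (prevRow r i , j) ≡ edge j (prevRow r i)
    fromPrev = trans (consecutive-sym L _ _) (cong (λ k → consecutive L (prevRow r i , j) (k , j)) (sym (nextRow-prevRow i<r)))
    rungAt : ∀ {j} → j ≤ 1 → consecutive L (i , j) (i , 1 ∸ j) ≡ rung i
    rungAt {zero} _ = refl
    rungAt {suc zero} _ = consecutive-sym L _ _
    rungAt {suc (suc _)} (s≤s ())

  module _ (3≤r : 3 ≤ r) where

    private
      2≤r : 2 ≤ r
      2≤r = ≤-trans (n≤1+n 2) 3≤r

      inNeighbours : ∀ {i j} → j ≤ 1 → ∀ w → Adj r c (i , j) w → col w ≤ 1 → w ∈ neighbours r i j
      inNeighbours j≤1 w adj w≤1 = neighbours-complete j≤1 w≤1 adj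

    innerRow : ∀ i j → i < r → j ≤ 1 → ¬ (i , j) ≡ (0 , 0) → ¬ (i , j) ≡ (a , 1) →
               deg₃ (edge j (prevRow r i)) (edge j i) (rung i) ≡ 2
    innerRow i j i<r j≤1 ≢start ≢end =
      trans (sym (ladderDegree j i<r j≤1))
            (degree-inner (covers i j i<r j≤1) (neighbours-unique 3≤r i<r j≤1) (∉neighbours 2≤r i<r j≤1)
                          (inNeighbours j≤1) ≢start ≢end)

    startRow : deg₃ (edge 0 (r ∸ 1)) (edge 0 0) (rung 0) ≡ 1
    startRow =
      trans (sym (ladderDegree 0 0<r z≤n))
            (degree-start (covers 0 0 0<r z≤n) (neighbours-unique 3≤r 0<r z≤n) (∉neighbours 2≤r 0<r z≤n)
                          (inNeighbours z≤n) refl (0≢1+n ∘ ,-injectiveʳ))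
      where
      0<r : 0 < r
      0<r = ≤-trans (s≤s z≤n) 3≤r

    endRow : deg₃ (edge 1 (prevRow r a)) (edge 1 a) (rung a) ≡ 1
    endRow =
      trans (sym (ladderDegree 1 a<r ≤-refl))
            (degree-end (covers a 1 a<r ≤-refl) (neighbours-unique 3≤r a<r ≤-refl) (∉neighbours 2≤r a<r ≤-refl)
                        (inNeighbours ≤-refl) (0≢1+n ∘ sym ∘ ,-injectiveʳ) refl)

    endRowDichotomy : ∀ a′ → a ≡ suc a′ →
      (∃[ k ] a′ ≡ 2 * k + 1 × (∀ t → t < 2 * k + 1 → rung (suc t) ≡ true))
      ⊎ (∃[ k ] r ∸ suc (suc a′) ≡ 2 * k + 1 × (∀ t → t < 2 * k + 1 → rung (suc (suc a′ + t)) ≡ true))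
    endRowDichotomy a′ refl =
      Ladder.endpointDichotomy (edge 0) (edge 1) rung a′ d
        (λ i i+1<r → innerRow (suc i) 0 (<r i+1<r) z≤n (0≢1+n ∘ sym ∘ ,-injectiveˡ) (0≢1+n ∘ ,-injectiveʳ))
        (λ i i+1<r i+1≢a → innerRow (suc i) 1 (<r i+1<r) ≤-refl (0≢1+n ∘ sym ∘ ,-injectiveʳ) (i+1≢a ∘ ,-injectiveˡ))
        endRow
        (subst (λ k → deg₃ (edge 0 k) (edge 0 0) (rung 0) ≡ 1) r∸1≡a+d startRow)
        (subst (λ k → deg₃ (edge 1 k) (edge 1 0) (rung 0) ≡ 2) r∸1≡a+d
               (innerRow 0 1 (≤-trans (s≤s z≤n) 3≤r) ≤-refl (0≢1+n ∘ sym ∘ ,-injectiveʳ) (0≢1+n ∘ ,-injectiveˡ)))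
      where
      d : ℕ
      d = r ∸ suc (suc a′)
      r≡ : suc (suc a′ + d) ≡ r
      r≡ = m+[n∸m]≡n a<r
      <r : ∀ {i} → i < suc (suc a′ + d) → i < r
      <r {i} = subst (i <_) r≡
      r∸1≡a+d : r ∸ 1 ≡ suc a′ + d
      r∸1≡a+d = cong (_∸ 1) (sym r≡)

-- For r = 2 the vertices (1 , 0) and (0 , 1) have only the neighbours (0 , 0) and (1 , 1); if the path ended
-- at (1 , 1) both would be interior and use their edges to (0 , 0), giving the endpoint (0 , 0) degree 2.
twoRows⇒end≡0 : ∀ {c L a} → TwoColumnPath 2 c L a → a ≡ 0
twoRows⇒end≡0 {a = zero} _ = refl
twoRows⇒end≡0 {a = suc (suc _)} P = ⊥-elim (<⇒≱ (TwoColumnPath.a<r P) (s≤s (s≤s z≤n)))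
twoRows⇒end≡0 {c} {L} {a = suc zero} P = ⊥-elim (1≢2 startDegree)
  where
  open TwoColumnPath P
  open TwoColumns P

  -- with two rows the previous and the next row coincide
  near₂ : ∀ {i j} → i < 2 → j ≤ 1 → ∀ w → Adj 2 c (i , j) w → col w ≤ 1 → w ∈ (prevRow 2 i , j) ∷ (i , 1 ∸ j) ∷ []
  near₂ {zero} _ j≤1 w adj w≤1 with neighbours-complete j≤1 w≤1 adj
  ... | here e = here e
  ... | there m = m
  near₂ {suc zero} _ j≤1 w adj w≤1 with neighbours-complete j≤1 w≤1 adj
  ... | here e = here e
  ... | there m = m
  near₂ {suc (suc _)} (s≤s (s≤s ())) _ _ _ _

  both : ∀ {x y} → ⟦ x ⟧ + (⟦ y ⟧ + 0) ≡ 2 → x ≡ true × y ≡ true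
  both {true} {true} _ = refl , refl
  both {true} {false} ()
  both {false} {true} ()
  both {false} {false} ()

  vertical₀ : consecutive L (1 , 0) (0 , 0) ≡ true
  vertical₀ = proj₁ (both {y = consecutive L (1 , 0) (1 , 1)} (degree-inner (covers 1 0 ≤-refl z≤n) ((0≢1+n ∘ ,-injectiveʳ ∷ []) ∷ [] ∷ [])
                         (λ { (here e) → 0≢1+n (sym (,-injectiveˡ e)) ; (there (here e)) → 0≢1+n (,-injectiveʳ e) })
                         (near₂ ≤-refl z≤n) (0≢1+n ∘ sym ∘ ,-injectiveˡ) (0≢1+n ∘ ,-injectiveʳ)))

  rung₀ : consecutive L (0 , 1) (0 , 0) ≡ true
  rung₀ = proj₂ (both {consecutive L (0 , 1) (1 , 1)} (degree-inner (covers 0 1 (s≤s z≤n) ≤-refl) ((0≢1+n ∘ sym ∘ ,-injectiveʳ ∷ []) ∷ [] ∷ [])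
                         (λ { (here e) → 0≢1+n (,-injectiveˡ e) ; (there (here e)) → 0≢1+n (sym (,-injectiveʳ e)) })
                         (near₂ (s≤s z≤n) ≤-refl) (0≢1+n ∘ sym ∘ ,-injectiveʳ) (0≢1+n ∘ ,-injectiveˡ)))

  startDegree : countTrue (consecutive L (0 , 0)) ((1 , 0) ∷ (0 , 1) ∷ []) ≡ 1
  startDegree = degree-start (covers 0 0 (s≤s z≤n) z≤n) ((0≢1+n ∘ sym ∘ ,-injectiveˡ ∷ []) ∷ [] ∷ [])
                  (λ { (here e) → 0≢1+n (,-injectiveˡ e) ; (there (here e)) → 0≢1+n (,-injectiveʳ e) })
                  (near₂ (s≤s z≤n) z≤n) refl (0≢1+n ∘ ,-injectiveʳ)

  1≢2 : ¬ countTrue (consecutive L (0 , 0)) ((1 , 0) ∷ (0 , 1) ∷ []) ≡ 1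
  1≢2 rewrite consecutive-sym L (0 , 0) (1 , 0) | vertical₀ | consecutive-sym L (0 , 0) (0 , 1) | rung₀ = λ ()

-- Counting rungs

sumBelow : ℕ → (ℕ → ℕ) → ℕ
sumBelow zero f = 0
sumBelow (suc d) f = sumBelow d f + f d

sumBelow-mono : ∀ d {f g} → (∀ t → f t ≤ g t) → sumBelow d f ≤ sumBelow d g
sumBelow-mono zero _ = z≤n
sumBelow-mono (suc d) f≤g = +-mono-≤ (sumBelow-mono d f≤g) (f≤g d)

sumBelow-+ : ∀ d f g → sumBelow d (λ t → f t + g t) ≡ sumBelow d f + sumBelow d g
sumBelow-+ zero f g = refl
sumBelow-+ (suc d) f g rewrite sumBelow-+ d f g = interchange (sumBelow d f) (sumBelow d g) (f d) (g d)

sumBelow-0 : ∀ d {f} → (∀ t → t < d → f t ≡ 0) → sumBelow d f ≡ 0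
sumBelow-0 zero _ = refl
sumBelow-0 (suc d) f≡0 rewrite f≡0 d ≤-refl = trans (+-identityʳ _) (sumBelow-0 d (λ t t<d → f≡0 t (m≤n⇒m≤1+n t<d)))

sumBelow-1 : ∀ d {f} → (∀ t → t < d → f t ≡ 1) → sumBelow d f ≡ d
sumBelow-1 zero _ = refl
sumBelow-1 (suc d) f≡1 rewrite f≡1 d ≤-refl | sumBelow-1 d (λ t t<d → f≡1 t (m≤n⇒m≤1+n t<d)) = +-comm d 1

sumBelow-atMostOne : ∀ d (f : ℕ → Bool) b → (∀ t → f t ≡ true → b ≡ true) → (∀ t t′ → f t ≡ true → f t′ ≡ true → t ≡ t′) →
                     sumBelow d (λ t → ⟦ f t ⟧) ≤ ⟦ b ⟧
sumBelow-atMostOne zero f b _ _ = z≤n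
sumBelow-atMostOne (suc d) f b ⇒b once with f d in fd
... | false = subst (_≤ ⟦ b ⟧) (sym (+-identityʳ _)) (sumBelow-atMostOne d f b ⇒b once)
... | true rewrite ⇒b d fd | sumBelow-0 d (λ t t<d → cong ⟦_⟧ (≢true⇒≡false (λ ft → <-irrefl (once t d ft fd) t<d))) = ≤-refl

rungsBelow≤hcount : ∀ L lo d → sumBelow d (λ t → ⟦ consecutive L (lo + t , 0) (lo + t , 1) ⟧) ≤ hcount 0 L
rungsBelow≤hcount [] lo d = ≤-reflexive (sumBelow-0 d (λ _ _ → refl))
rungsBelow≤hcount (u ∷ []) lo d = ≤-reflexive (sumBelow-0 d (λ _ _ → refl))
rungsBelow≤hcount (u ∷ v ∷ L) lo d = begin
  sumBelow d (λ t → ⟦ now t ∨ later t ⟧)             ≤⟨ sumBelow-mono d (λ t → ⟦∨⟧≤ (now t) (later t)) ⟩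
  sumBelow d (λ t → ⟦ now t ⟧ + ⟦ later t ⟧)         ≡⟨ sumBelow-+ d _ _ ⟩
  sumBelow d (λ t → ⟦ now t ⟧) + sumBelow d (λ t → ⟦ later t ⟧)
    ≤⟨ +-mono-≤ (sumBelow-atMostOne d now (isHj 0 u v) now⇒crossing nowOnce) (rungsBelow≤hcount (v ∷ L) lo d) ⟩
  ⟦ isHj 0 u v ⟧ + hcount 0 (v ∷ L)                   ∎
  where
  open ≤-Reasoning
  now later : ℕ → Bool
  now t = isEdge u v (lo + t , 0) (lo + t , 1)
  later t = consecutive (v ∷ L) (lo + t , 0) (lo + t , 1)
  ⟦∨⟧≤ : ∀ p q → ⟦ p ∨ q ⟧ ≤ ⟦ p ⟧ + ⟦ q ⟧
  ⟦∨⟧≤ true q = s≤s z≤n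
  ⟦∨⟧≤ false q = ≤-refl
  now⇒crossing : ∀ t → now t ≡ true → isHj 0 u v ≡ true
  now⇒crossing t e with isEdge-true⇒ u v _ _ e
  ... | inj₁ (refl , refl) = isHj-right 0 u v refl refl
  ... | inj₂ (refl , refl) = isHj-left 0 u v refl refl
  now⇒row : ∀ t → now t ≡ true → row u ≡ lo + t
  now⇒row t e with isEdge-true⇒ u v _ _ e
  ... | inj₁ (refl , refl) = refl
  ... | inj₂ (refl , refl) = refl
  nowOnce : ∀ t t′ → now t ≡ true → now t′ ≡ true → t ≡ t′
  nowOnce t t′ e e′ = +-cancelˡ-≡ lo t t′ (trans (sym (now⇒row t e)) (now⇒row t′ e′))

rungs≤hcount : ∀ L lo d → (∀ t → t < d → consecutive L (lo + t , 0) (lo + t , 1) ≡ true) → d ≤ hcount 0 L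
rungs≤hcount L lo d rungs =
  subst (_≤ hcount 0 L) (sumBelow-1 d (λ t t<d → cong ⟦_⟧ (rungs t t<d))) (rungsBelow≤hcount L lo d)

-- GG paths restricted to the first two columns

RowAdj : ℕ → ℕ → ℕ → Set
RowAdj r i i′ = suc i ≡ i′ ⊎ suc i′ ≡ i ⊎ (i ≡ 0 × suc i′ ≡ r) ⊎ (i′ ≡ 0 × suc i ≡ r)

adj-vertical : ∀ {r c i i′ j} → i < r → i′ < r → j < c → RowAdj r i i′ → Adj r c (i , j) (i′ , j)
adj-vertical i<r i′<r j<c step = (i<r , j<c) , (i′<r , j<c) , inj₂ (refl , step)

adj-rung : ∀ {r c i} → i < r → 2 ≤ c → Adj r c (i , 0) (i , 1)
adj-rung i<r 2≤c = (i<r , ≤-trans (s≤s z≤n) 2≤c) , (i<r , 2≤c) , inj₁ (refl , inj₁ refl)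

alt-∈⁻ : ∀ b rows x → x ∈ alt b rows → ∃[ y ] y ∈ rows × (x ≡ (y , 0) ⊎ x ≡ (y , 1))
alt-∈⁻ true (a ∷ as) x (here refl) = a , here refl , inj₁ refl
alt-∈⁻ true (a ∷ as) x (there (here refl)) = a , here refl , inj₂ refl
alt-∈⁻ false (a ∷ as) x (here refl) = a , here refl , inj₂ refl
alt-∈⁻ false (a ∷ as) x (there (here refl)) = a , here refl , inj₁ refl
alt-∈⁻ true (a ∷ as) x (there (there m)) with alt-∈⁻ false as x m
... | y , y∈as , e = y , there y∈as , e
alt-∈⁻ false (a ∷ as) x (there (there m)) with alt-∈⁻ true as x m
... | y , y∈as , e = y , there y∈as , e

alt-∈⁺ : ∀ b rows {y j} → y ∈ rows → j ≤ 1 → (y , j) ∈ alt b rows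
alt-∈⁺ true (a ∷ as) {j = zero} (here refl) _ = here refl
alt-∈⁺ true (a ∷ as) {j = suc zero} (here refl) _ = there (here refl)
alt-∈⁺ false (a ∷ as) {j = zero} (here refl) _ = there (here refl)
alt-∈⁺ false (a ∷ as) {j = suc zero} (here refl) _ = here refl
alt-∈⁺ b (a ∷ as) {j = suc (suc _)} (here refl) (s≤s ())
alt-∈⁺ true (a ∷ as) (there m) j≤1 = there (there (alt-∈⁺ false as m j≤1))
alt-∈⁺ false (a ∷ as) (there m) j≤1 = there (there (alt-∈⁺ true as m j≤1))

alt-∈⇒row∈ : ∀ b rows {x} → x ∈ alt b rows → row x ∈ rows
alt-∈⇒row∈ b rows {x} m with alt-∈⁻ b rows x m
... | y , y∈ , inj₁ refl = y∈
... | y , y∈ , inj₂ refl = y∈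

alt-unique : ∀ b rows → Unique rows → Unique (alt b rows)
alt-unique b [] _ = []
alt-unique true (a ∷ as) (a∉ ∷ u) =
  ((0≢1+n ∘ ,-injectiveʳ) ∷ otherRows) ∷ otherRows ∷ alt-unique false as u
  where
  otherRows : ∀ {j} → All (λ x → ¬ (a , j) ≡ x) (alt false as)
  otherRows = All.tabulate λ m e → All.lookup a∉ (alt-∈⇒row∈ false as m) (,-injectiveˡ e)
alt-unique false (a ∷ as) (a∉ ∷ u) =
  ((0≢1+n ∘ sym ∘ ,-injectiveʳ) ∷ otherRows) ∷ otherRows ∷ alt-unique true as u
  where
  otherRows : ∀ {j} → All (λ x → ¬ (a , j) ≡ x) (alt true as)
  otherRows = All.tabulate λ m e → All.lookup a∉ (alt-∈⇒row∈ true as m) (,-injectiveˡ e)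

alt-linked : ∀ {r c} b rows → 2 ≤ c → All (_< r) rows → Linked (RowAdj r) rows → Linked (Adj r c) (alt b rows)
alt-linked b [] _ _ _ = []
alt-linked true (a ∷ []) 2≤c (a<r ∷ _) _ = adj-rung a<r 2≤c ∷ [-]
alt-linked false (a ∷ []) 2≤c (a<r ∷ _) _ = adj-sym (adj-rung a<r 2≤c) ∷ [-]
alt-linked true (a ∷ a′ ∷ as) 2≤c (a<r ∷ a′<r ∷ <r) (step ∷ l) =
  adj-rung a<r 2≤c ∷ adj-vertical a<r a′<r 2≤c step ∷ alt-linked false (a′ ∷ as) 2≤c (a′<r ∷ <r) l
alt-linked false (a ∷ a′ ∷ as) 2≤c (a<r ∷ a′<r ∷ <r) (step ∷ l) =
  adj-sym (adj-rung a<r 2≤c) ∷ adj-vertical a<r a′<r (≤-trans (s≤s z≤n) 2≤c) step ∷ alt-linked true (a′ ∷ as) 2≤c (a′<r ∷ <r) l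

alt-hTotal : ∀ b a as → hTotal (alt b (a ∷ as)) ≡ suc (length as)
alt-hTotal true a [] = refl
alt-hTotal false a [] = refl
alt-hTotal true a (a′ ∷ as) = cong suc (alt-hTotal false a′ as)
alt-hTotal false a (a′ ∷ as) = cong suc (alt-hTotal true a′ as)

alt-++-even : ∀ b xs ys m → length xs ≡ 2 * m → alt b (xs ++ ys) ≡ alt b xs ++ alt b ys
alt-++-even b [] ys m e = refl
alt-++-even b (x ∷ []) ys zero ()
alt-++-even b (x ∷ []) ys (suc m) e = ⊥-elim (0≢1+n (trans (suc-injective e) (+-suc m (m + 0))))
alt-++-even b (x ∷ y ∷ xs) ys zero ()
alt-++-even true (x ∷ y ∷ xs) ys (suc m) e =
  cong (λ z → (x , 0) ∷ (x , 1) ∷ (y , 1) ∷ (y , 0) ∷ z) (alt-++-even true xs ys m (suc-injective (trans (suc-injective e) (+-suc m (m + 0)))))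
alt-++-even false (x ∷ y ∷ xs) ys (suc m) e =
  cong (λ z → (x , 1) ∷ (x , 0) ∷ (y , 0) ∷ (y , 1) ∷ z) (alt-++-even false xs ys m (suc-injective (trans (suc-injective e) (+-suc m (m + 0)))))

hTotal-constantColumn : ∀ j xs → All (λ v → col v ≡ j) xs → hTotal xs ≡ 0
hTotal-constantColumn j [] _ = refl
hTotal-constantColumn j (x ∷ []) _ = refl
hTotal-constantColumn j (x ∷ y ∷ xs) (x≡j ∷ y≡j ∷ ≡j) =
  cong₂ _+_ (cong (if_then 0 else 1) (trans (cong₂ _≡ᵇ_ x≡j y≡j) (≡ᵇ-refl j))) (hTotal-constantColumn j (y ∷ xs) (y≡j ∷ ≡j))

hTotal-++-sameColumn : ∀ x xs y ys → col (lastOf x xs) ≡ col y → hTotal (x ∷ xs ++ y ∷ ys) ≡ hTotal (x ∷ xs) + hTotal (y ∷ ys)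
hTotal-++-sameColumn x [] y ys e rewrite e | ≡ᵇ-refl (col y) = refl
hTotal-++-sameColumn x (z ∷ xs) y ys e =
  trans (cong ((if col x ≡ᵇ col z then 0 else 1) +_) (hTotal-++-sameColumn z xs y ys e))
        (sym (+-assoc (if col x ≡ᵇ col z then 0 else 1) _ _))

hTotal-++-overlap : ∀ Q z R → hTotal ((Q ∷ʳ z) ++ R) ≡ hTotal (Q ∷ʳ z) + hTotal (z ∷ R)
hTotal-++-overlap [] z R = refl
hTotal-++-overlap (q ∷ []) z R = cong (_+ hTotal (z ∷ R)) (sym (+-identityʳ _))
hTotal-++-overlap (q ∷ q′ ∷ Q) z R =
  trans (cong ((if col q ≡ᵇ col q′ then 0 else 1) +_) (hTotal-++-overlap (q′ ∷ Q) z R))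
        (sym (+-assoc (if col q ≡ᵇ col q′ then 0 else 1) _ _))

-- The part in columns 0 and 1 of a GG path with 2k+1+(c-2) horizontal edges, which leaves column 1 at (a , 1).
record TwoColumnGG (r c k a : ℕ) : Set where
  field
    path arc : List V
    shape : path ≡ prefix1 r k ++ arc ⊎ path ≡ prefix2 r k ++ arc
    arc⊆column₁ : All (λ v → col v ≡ 1) arc
    2k+1≤r : 2 * k + 1 ≤ r
    unique : Unique path
    linked : Linked (Adj r c) path
    inColumns : All (λ v → row v < r × col v ≤ 1) path
    covers : ∀ i j → i < r → j ≤ 1 → (i , j) ∈ path
    ends : EndsAt path (a , 1)
    hTotal≡ : hTotal path ≡ 2 * k + 1

-- Column 0 is visited in rows ψ 0 , … , ψ n′, then the alternating block runs through the rows
-- ψ (n′ + 1) , … , ψ (r ∸ 1), and column 1 is finished in rows χ 0 , … , χ n′.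
module LadderPrefix (r c n′ k : ℕ) (ψ χ : ℕ → ℕ)
  (r≡ : suc n′ + suc (2 * k) ≡ r) (2≤c : 2 ≤ c)
  (ψ<r : ∀ i → i < r → ψ i < r)
  (ψ-injective : ∀ i i′ → i < r → i′ < r → ψ i ≡ ψ i′ → i ≡ i′)
  (ψ-surjective : ∀ y → y < r → ∃[ i ] i < r × ψ i ≡ y)
  (ψ-adjacent : ∀ i → suc i < r → RowAdj r (ψ i) (ψ (suc i)))
  (χ∈ψ : ∀ i → i < suc n′ → ∃[ j ] j < suc n′ × χ i ≡ ψ j)
  (χ-injective : ∀ i i′ → i < suc n′ → i′ < suc n′ → χ i ≡ χ i′ → i ≡ i′)
  (χ-surjective : ∀ j → j < suc n′ → ∃[ i ] i < suc n′ × χ i ≡ ψ j)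
  (χ-adjacent : ∀ i → suc i < suc n′ → RowAdj r (χ i) (χ (suc i)))
  (χ-start : RowAdj r (ψ (r ∸ 1)) (χ 0))
  where

  n K : ℕ
  n = suc n′
  K = suc (2 * k)

  at₀ at₁ : ℕ → V
  at₀ i = (ψ i , 0)
  at₁ i = (χ i , 1)

  blockRow : ℕ → ℕ
  blockRow t = ψ (n + t)

  column₀ block column₁ path : List V
  column₀ = applyUpTo at₀ n
  block = alt true (applyUpTo blockRow K)
  column₁ = applyUpTo at₁ n
  path = (column₀ ++ block) ++ column₁

  private
    n<r : ∀ {i} → i < n → i < r
    n<r i<n = subst (_ <_) r≡ (≤-trans i<n (m≤m+n n K))

    n+K<r : ∀ {t} → t < K → n + t < r
    n+K<r t<K = subst (_ <_) r≡ (+-monoʳ-< n t<K)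

    χ<r : ∀ i → i < n → χ i < r
    χ<r i i<n with χ∈ψ i i<n
    ... | j , j<n , χi≡ψj = subst (_< r) (sym χi≡ψj) (ψ<r j (n<r j<n))

    blockRow-∈ : ∀ {y} → y ∈ applyUpTo blockRow K → ∃[ t ] t < K × y ≡ blockRow t
    blockRow-∈ = ∈-applyUpTo⁻ blockRow

    r∸1≡ : r ∸ 1 ≡ n + 2 * k
    r∸1≡ = trans (cong (_∸ 1) (sym r≡)) (+-suc n′ (2 * k))

  inColumns : All (λ v → row v < r × col v ≤ 1) path
  inColumns = All.tabulate bounds
    where
    bounds : ∀ {x} → x ∈ path → row x < r × col x ≤ 1
    bounds m with ∈-++⁻ (column₀ ++ block) m
    ... | inj₂ m₁ with ∈-applyUpTo⁻ at₁ m₁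
    ...   | i , i<n , refl = χ<r i i<n , ≤-refl
    bounds m | inj₁ m₀b with ∈-++⁻ column₀ m₀b
    ... | inj₁ m₀ with ∈-applyUpTo⁻ at₀ m₀
    ...   | i , i<n , refl = ψ<r i (n<r i<n) , z≤n
    bounds m | inj₁ m₀b | inj₂ mb with alt-∈⁻ true _ _ mb
    ... | y , y∈ , x≡ with blockRow-∈ y∈
    ...   | t , t<K , refl with x≡
    ...     | inj₁ refl = ψ<r (n + t) (n+K<r t<K) , z≤n
    ...     | inj₂ refl = ψ<r (n + t) (n+K<r t<K) , ≤-refl

  covers : ∀ i j → i < r → j ≤ 1 → (i , j) ∈ path
  covers i j i<r j≤1 with ψ-surjective i i<r
  ... | p , p<r , refl with p <? n
  ...   | yes p<n = inColumn j j≤1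
    where
    inColumn : ∀ j → j ≤ 1 → (ψ p , j) ∈ path
    inColumn zero _ = ∈-++⁺ˡ (∈-++⁺ˡ (∈-applyUpTo⁺ at₀ p<n))
    inColumn (suc zero) _ with χ-surjective p p<n
    ... | q , q<n , χq≡ψp = ∈-++⁺ʳ (column₀ ++ block) (subst (λ y → (y , 1) ∈ column₁) χq≡ψp (∈-applyUpTo⁺ at₁ q<n))
    inColumn (suc (suc _)) (s≤s ())
  ...   | no p≮n = ∈-++⁺ˡ (∈-++⁺ʳ column₀ (subst (λ q → (ψ q , j) ∈ block) n+t≡p
                     (alt-∈⁺ true (applyUpTo blockRow K) (∈-applyUpTo⁺ blockRow t<K) j≤1)))
    where
    t : ℕ
    t = p ∸ n
    n+t≡p : n + t ≡ p
    n+t≡p = m+[n∸m]≡n (≮⇒≥ p≮n)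
    t<K : t < K
    t<K = +-cancelˡ-< n t K (subst (_< n + K) (sym n+t≡p) (subst (p <_) (sym r≡) p<r))

  unique : Unique path
  unique = Unique.++⁺ (Unique.++⁺ unique₀ uniqueBlock column₀∩block) unique₁ rest∩column₁
    where
    unique₀ : Unique column₀
    unique₀ = Unique.applyUpTo⁺₁ at₀ n (λ i<j j<n e → <⇒≢ i<j (ψ-injective _ _ (n<r (<-trans i<j j<n)) (n<r j<n) (,-injectiveˡ e)))
    unique₁ : Unique column₁
    unique₁ = Unique.applyUpTo⁺₁ at₁ n (λ i<j j<n e → <⇒≢ i<j (χ-injective _ _ (<-trans i<j j<n) j<n (,-injectiveˡ e)))
    uniqueBlock : Unique block
    uniqueBlock = alt-unique true _ (Unique.applyUpTo⁺₁ blockRow K (λ {i} {j} i<j j<K e →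
                    <⇒≢ i<j (+-cancelˡ-≡ n i j (ψ-injective (n + i) (n + j) (n+K<r (<-trans i<j j<K)) (n+K<r j<K) e))))
    blockRowOf : ∀ {x} → x ∈ block → ∃[ t ] t < K × row x ≡ blockRow t
    blockRowOf m = blockRow-∈ (alt-∈⇒row∈ true _ m)
    notInBlock : ∀ {i t} → i < n → t < K → ¬ ψ i ≡ blockRow t
    notInBlock {i} {t} i<n t<K e = <⇒≱ i<n (subst (n ≤_) (sym (ψ-injective i (n + t) (n<r i<n) (n+K<r t<K) e)) (m≤m+n n t))
    column₀∩block : ∀ {v} → ¬ (v ∈ column₀ × v ∈ block)
    column₀∩block (m₀ , mb) with ∈-applyUpTo⁻ at₀ m₀ | blockRowOf mb
    ... | i , i<n , refl | t , t<K , e = notInBlock i<n t<K e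
    rest∩column₁ : ∀ {v} → ¬ (v ∈ column₀ ++ block × v ∈ column₁)
    rest∩column₁ (m , m₁) with ∈-applyUpTo⁻ at₁ m₁
    ... | i , i<n , refl with χ∈ψ i i<n | ∈-++⁻ column₀ m
    ...   | _ , _ , _ | inj₁ m₀ = 0≢1+n (sym (,-injectiveʳ (proj₂ (proj₂ (∈-applyUpTo⁻ at₀ m₀)))))
    ...   | j , j<n , χi≡ψj | inj₂ mb with blockRowOf mb
    ...     | t , t<K , e = notInBlock j<n t<K (trans (sym χi≡ψj) e)

  private
    blockTail : List V
    blockTail = (blockRow 0 , 1) ∷ alt false (applyUpTo (blockRow ∘ suc) (2 * k))

    lastOfBlock : lastOf (blockRow 0 , 0) blockTail ≡ (ψ (r ∸ 1) , 1)
    lastOfBlock = begin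
      lastOf (blockRow 0 , 0) blockTail
        ≡⟨ cong lastOfList blockSplit ⟩
      lastOfList (alt true (applyUpTo blockRow (2 * k)) ++ (blockRow (2 * k) , 0) ∷ [ (blockRow (2 * k) , 1) ])
        ≡⟨ lastOfList-++ (alt true (applyUpTo blockRow (2 * k))) ⟩
      (blockRow (2 * k) , 1)
        ≡⟨ cong (λ i → (ψ i , 1)) (sym r∸1≡) ⟩
      (ψ (r ∸ 1) , 1) ∎
      where
      open ≡-Reasoning
      lastOfList : List V → V
      lastOfList [] = (0 , 0)
      lastOfList (x ∷ xs) = lastOf x xs
      lastOfList-++ : ∀ X {p ys} → lastOfList (X ++ p ∷ ys) ≡ lastOf p ys
      lastOfList-++ [] = refl
      lastOfList-++ (x ∷ X) = lastOf-++ x X _ _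
      blockSplit : block ≡ alt true (applyUpTo blockRow (2 * k)) ++ (blockRow (2 * k) , 0) ∷ [ (blockRow (2 * k) , 1) ]
      blockSplit = trans (cong (alt true) (sym (applyUpTo-∷ʳ blockRow (2 * k))))
                         (alt-++-even true (applyUpTo blockRow (2 * k)) [ blockRow (2 * k) ] k (length-applyUpTo blockRow (2 * k)))

    lastOfColumn₀ : lastOf (at₀ 0) (applyUpTo (at₀ ∘ suc) n′) ≡ at₀ n′
    lastOfColumn₀ = lastOf-applyUpTo at₀ n′

    lastOfColumn₀++block : lastOf (at₀ 0) (applyUpTo (at₀ ∘ suc) n′ ++ (blockRow 0 , 0) ∷ blockTail) ≡ (ψ (r ∸ 1) , 1)
    lastOfColumn₀++block = trans (lastOf-++ (at₀ 0) (applyUpTo (at₀ ∘ suc) n′) (blockRow 0 , 0) blockTail) lastOfBlock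

    n<r′ : n < r
    n<r′ = subst (_< r) (+-identityʳ n) (n+K<r (s≤s z≤n))

  linked : Linked (Adj r c) path
  linked = Linked-join (at₀ 0) _ (at₁ 0) _ (Linked-join (at₀ 0) _ (blockRow 0 , 0) blockTail linked₀ linkedBlock column₀→block)
             linked₁ block→column₁
    where
    0<c : 0 < c
    0<c = ≤-trans (s≤s z≤n) 2≤c
    linked₀ : Linked (Adj r c) column₀
    linked₀ = Linked.applyUpTo⁺₁ at₀ n (λ {i} i+1<n →
                adj-vertical (ψ<r i (n<r (<-trans (n<1+n i) i+1<n))) (ψ<r (suc i) (n<r i+1<n)) 0<c (ψ-adjacent i (n<r i+1<n)))
    linked₁ : Linked (Adj r c) column₁
    linked₁ = Linked.applyUpTo⁺₁ at₁ n (λ {i} i+1<n →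
                adj-vertical (χ<r i (<-trans (n<1+n i) i+1<n)) (χ<r (suc i) i+1<n) 2≤c (χ-adjacent i i+1<n))
    linkedBlock : Linked (Adj r c) block
    linkedBlock = alt-linked true _ 2≤c
      (All.tabulate λ m → let t , t<K , e = blockRow-∈ m in subst (_< r) (sym e) (ψ<r (n + t) (n+K<r t<K)))
      (Linked.applyUpTo⁺₁ blockRow K (λ {i} i+1<K → subst (λ z → RowAdj r (ψ (n + i)) (ψ z)) (sym (+-suc n i))
         (ψ-adjacent (n + i) (subst (_< r) (+-suc n i) (n+K<r i+1<K)))))
    column₀→block : Adj r c (lastOf (at₀ 0) (applyUpTo (at₀ ∘ suc) n′)) (blockRow 0 , 0)
    column₀→block rewrite lastOfColumn₀ | +-identityʳ n =
      adj-vertical (ψ<r n′ (<-trans (n<1+n n′) n<r′)) (ψ<r n n<r′) 0<c (ψ-adjacent n′ n<r′)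
    block→column₁ : Adj r c (lastOf (at₀ 0) (applyUpTo (at₀ ∘ suc) n′ ++ block)) (at₁ 0)
    block→column₁ rewrite lastOfColumn₀++block =
      adj-vertical (ψ<r (r ∸ 1) (subst (_< r) (sym r∸1≡) (n+K<r ≤-refl))) (χ<r 0 (s≤s z≤n)) 2≤c χ-start

  private
    inColumn : ∀ {j} (f : ℕ → ℕ) → All (λ v → col v ≡ j) (applyUpTo (λ i → (f i , j)) n)
    inColumn {j} f = All.tabulate λ m → let _ , _ , e = ∈-applyUpTo⁻ (λ i → (f i , j)) m in cong col e

  hTotal≡ : hTotal path ≡ K
  hTotal≡ = begin
    hTotal path
      ≡⟨ hTotal-++-sameColumn (at₀ 0) (applyUpTo (at₀ ∘ suc) n′ ++ block) (at₁ 0) (applyUpTo (at₁ ∘ suc) n′)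
                              (cong col lastOfColumn₀++block) ⟩
    hTotal (column₀ ++ block) + hTotal column₁
      ≡⟨ cong₂ _+_ (hTotal-++-sameColumn (at₀ 0) (applyUpTo (at₀ ∘ suc) n′) (blockRow 0 , 0) blockTail (cong col lastOfColumn₀))
                   (hTotal-constantColumn 1 column₁ (inColumn χ)) ⟩
    hTotal column₀ + hTotal block + 0
      ≡⟨ cong (λ h → h + hTotal block + 0) (hTotal-constantColumn 0 column₀ (inColumn ψ)) ⟩
    hTotal block + 0
      ≡⟨ +-identityʳ _ ⟩
    hTotal block
      ≡⟨ alt-hTotal true (blockRow 0) (applyUpTo (blockRow ∘ suc) (2 * k)) ⟩
    suc (length (applyUpTo (blockRow ∘ suc) (2 * k)))
      ≡⟨ cong suc (length-applyUpTo (blockRow ∘ suc) (2 * k)) ⟩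
    K ∎
    where open ≡-Reasoning

  twoColumnGG : ∀ a → (prefix1 r k ≡ column₀ ++ block ⊎ prefix2 r k ≡ column₀ ++ block) → χ n′ ≡ a → TwoColumnGG r c k a
  twoColumnGG a isPrefix χn′≡a = record
    { path = path ; arc = column₁
    ; shape = shape isPrefix
    ; arc⊆column₁ = inColumn χ
    ; 2k+1≤r = subst (_≤ r) (+-comm 1 (2 * k)) (subst (K ≤_) r≡ (m≤n+m K n))
    ; unique = unique ; linked = linked ; inColumns = inColumns ; covers = covers
    ; ends = (column₀ ++ block) ++ applyUpTo at₁ n′ , (begin
        path                                                     ≡⟨ cong ((column₀ ++ block) ++_) (sym (applyUpTo-∷ʳ at₁ n′)) ⟩
        (column₀ ++ block) ++ (applyUpTo at₁ n′ ∷ʳ at₁ n′)       ≡⟨ sym (++-assoc (column₀ ++ block) _ [ at₁ n′ ]) ⟩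
        ((column₀ ++ block) ++ applyUpTo at₁ n′) ∷ʳ (χ n′ , 1)   ≡⟨ cong (λ y → ((column₀ ++ block) ++ applyUpTo at₁ n′) ∷ʳ (y , 1)) χn′≡a ⟩
        ((column₀ ++ block) ++ applyUpTo at₁ n′) ∷ʳ (a , 1)      ∎)
    ; hTotal≡ = trans hTotal≡ (+-comm 1 (2 * k))
    }
    where
    open ≡-Reasoning
    shape : (prefix1 r k ≡ column₀ ++ block ⊎ prefix2 r k ≡ column₀ ++ block) →
            path ≡ prefix1 r k ++ column₁ ⊎ path ≡ prefix2 r k ++ column₁
    shape (inj₁ e) = inj₁ (cong (_++ column₁) (sym e))
    shape (inj₂ e) = inj₂ (cong (_++ column₁) (sym e))

prefix1-as : ∀ r k n → r ∸ (2 * k + 1) ≡ n →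
             prefix1 r k ≡ applyUpTo (λ i → (i , 0)) n ++ alt true (applyUpTo (n +_) (suc (2 * k)))
prefix1-as r k n e = cong₂ _++_ (trans (map-upTo _ _) (cong (applyUpTo (λ i → (i , 0))) e))
  (cong (alt true) (trans (map-upTo _ _) (trans (applyUpTo-cong _ (λ t → cong (_+ t) e))
     (cong (applyUpTo (n +_)) (+-comm (2 * k) 1)))))

prefix2-as : ∀ r k n → n + suc (2 * k) ≡ r →
             prefix2 r k ≡ applyUpTo (λ i → (wrap r (r ∸ i) , 0)) n ++ alt true (applyUpTo (λ t → wrap r (r ∸ (n + t))) (suc (2 * k)))
prefix2-as r k n r≡ = cong₂ _++_ (trans (map-upTo _ _) (cong (applyUpTo (λ i → (wrap r (r ∸ i) , 0))) r∸K≡n))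
  (cong (alt true) (trans (map-upTo _ _) (trans (applyUpTo-cong _ reflected)
     (cong (applyUpTo (λ t → wrap r (r ∸ (n + t)))) (+-comm (2 * k) 1)))))
  where
  r∸K≡n : r ∸ (2 * k + 1) ≡ n
  r∸K≡n = trans (cong₂ _∸_ (sym r≡) (+-comm (2 * k) 1)) (m+n∸n≡m n (suc (2 * k)))
  reflected : ∀ t → wrap r (2 * k + 1 ∸ t) ≡ wrap r (r ∸ (n + t))
  reflected t = cong (wrap r) (sym (begin
    r ∸ (n + t)                  ≡⟨ cong (_∸ (n + t)) (sym r≡) ⟩
    (n + suc (2 * k)) ∸ (n + t)  ≡⟨ [m+n]∸[m+o]≡n∸o n (suc (2 * k)) t ⟩
    suc (2 * k) ∸ t              ≡⟨ cong (_∸ t) (+-comm 1 (2 * k)) ⟩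
    2 * k + 1 ∸ t                ∎))
    where open ≡-Reasoning

form₁ : ∀ r c k a → 2 ≤ c → suc a + suc (2 * k) ≡ r → TwoColumnGG r c k a
form₁ r c k a 2≤c r≡ = LadderPrefix.twoColumnGG r c a k (λ i → i) (λ i → i) r≡ 2≤c
  (λ _ i<r → i<r) (λ _ _ _ _ e → e) (λ y y<r → y , y<r , refl) (λ _ _ → inj₁ refl)
  (λ i i<n → i , i<n , refl) (λ _ _ _ _ e → e) (λ j j<n → j , j<n , refl) (λ _ _ → inj₁ refl)
  (inj₂ (inj₂ (inj₂ (refl , m+[n∸m]≡n (subst (1 ≤_) r≡ (s≤s z≤n))))))
  a (inj₁ (prefix1-as r k (suc a) (trans (cong₂ _∸_ (sym r≡) (+-comm (2 * k) 1)) (m+n∸n≡m (suc a) (suc (2 * k)))))) refl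

-- The k = 0 path of Form 1 that climbs column 1 back to row 0.
form₁-toRow0 : ∀ c n′ → 2 ≤ c → TwoColumnGG (suc (suc n′)) c 0 0
form₁-toRow0 c n′ 2≤c = LadderPrefix.twoColumnGG (suc (suc n′)) c n′ 0 (λ i → i) (n′ ∸_) (+-comm (suc n′) 1) 2≤c
  (λ _ i<r → i<r) (λ _ _ _ _ e → e) (λ y y<r → y , y<r , refl) (λ _ _ → inj₁ refl)
  (λ i _ → n′ ∸ i , s≤s (m∸n≤m n′ i) , refl)
  (λ _ _ i<n i′<n e → ∸-cancelˡ-≡ (≤-pred i<n) (≤-pred i′<n) e)
  (λ j j<n → n′ ∸ j , s≤s (m∸n≤m n′ j) , m∸[m∸n]≡n (≤-pred j<n))
  (λ i i+1<n → inj₂ (inj₁ (sym (+-∸-assoc 1 (≤-pred i+1<n)))))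
  (inj₂ (inj₁ refl))
  0 (inj₁ (prefix1-as (suc (suc n′)) 0 (suc n′) refl)) (n∸n≡0 n′)

-- Form 2 runs through the rows in the order 0 , r ∸ 1 , r ∸ 2 , … , 1.
module Reflection (r : ℕ) (2≤r : 2 ≤ r) where

  φ : ℕ → ℕ
  φ i = wrap r (r ∸ i)

  φ0 : φ 0 ≡ 0
  φ0 = wrap-self r

  r∸i+1<r : ∀ i → suc i ≤ r → r ∸ suc i < r
  r∸i+1<r i i<r = ∸-monoʳ-< {r} {suc i} {0} (s≤s z≤n) i<r

  φ-suc : ∀ i → suc i ≤ r → φ (suc i) ≡ r ∸ suc i
  φ-suc i i<r = wrap-< (r∸i+1<r i i<r)

  φ<r : ∀ i → i < r → φ i < r
  φ<r zero 0<r = subst (_< r) (sym φ0) 0<r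
  φ<r (suc i) i+1<r = subst (_< r) (sym (φ-suc i (<⇒≤ i+1<r))) (r∸i+1<r i (<⇒≤ i+1<r))

  φ-injective : ∀ i i′ → i < r → i′ < r → φ i ≡ φ i′ → i ≡ i′
  φ-injective zero zero _ _ _ = refl
  φ-injective zero (suc i′) _ i′<r e =
    ⊥-elim (<-irrefl refl (≤-trans i′<r (m∸n≡0⇒m≤n (sym (trans (sym φ0) (trans e (φ-suc i′ (<⇒≤ i′<r))))))))
  φ-injective (suc i) zero i<r _ e =
    ⊥-elim (<-irrefl refl (≤-trans i<r (m∸n≡0⇒m≤n (trans (sym (φ-suc i (<⇒≤ i<r))) (trans e φ0)))))
  φ-injective (suc i) (suc i′) i<r i′<r e =
    ∸-cancelˡ-≡ (<⇒≤ i<r) (<⇒≤ i′<r) (trans (sym (φ-suc i (<⇒≤ i<r))) (trans e (φ-suc i′ (<⇒≤ i′<r))))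

  φ-surjective : ∀ y → y < r → ∃[ i ] i < r × φ i ≡ y
  φ-surjective zero 0<r = 0 , 0<r , φ0
  φ-surjective (suc y) y<r = r ∸ suc y , r∸i+1<r y (<⇒≤ y<r) ,
    trans (cong (wrap r) (m∸[m∸n]≡n (<⇒≤ y<r))) (wrap-< y<r)

  φ-adjacent : ∀ i → suc i < r → RowAdj r (φ i) (φ (suc i))
  φ-adjacent zero 1<r = subst₂ (RowAdj r) (sym φ0) (sym (φ-suc 0 (<⇒≤ 1<r))) (inj₂ (inj₂ (inj₁ (refl , m+[n∸m]≡n {1} {r} (<⇒≤ 1<r)))))
  φ-adjacent (suc i) i+2<r = subst₂ (RowAdj r) (sym (φ-suc i (≤-trans (n≤1+n _) (<⇒≤ i+2<r)))) (sym (φ-suc (suc i) (<⇒≤ i+2<r)))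
                               (inj₂ (inj₁ (sym (+-∸-assoc 1 {r} {suc (suc i)} (<⇒≤ i+2<r)))))

  φ-last : φ (r ∸ 1) ≡ 1
  φ-last = trans (cong (wrap r) (m∸[m∸n]≡n {r} {1} (≤-trans (s≤s z≤n) 2≤r))) (wrap-< 2≤r)

form₂ : ∀ r c k n′ → 2 ≤ c → 2 ≤ r → suc n′ + suc (2 * k) ≡ r → 1 ≤ n′ → TwoColumnGG r c k (r ∸ n′)
form₂ r c k n′ 2≤c 2≤r r≡ 1≤n′ = LadderPrefix.twoColumnGG r c n′ k φ φ r≡ 2≤c
  φ<r φ-injective φ-surjective φ-adjacent
  (λ i i<n → i , i<n , refl) (λ i i′ i<n i′<n → φ-injective i i′ (n<r i<n) (n<r i′<n)) (λ j j<n → j , j<n , refl)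
  (λ i i+1<n → φ-adjacent i (n<r i+1<n))
  (subst₂ (RowAdj r) (sym φ-last) (sym φ0) (inj₂ (inj₁ refl)))
  (r ∸ n′) (inj₂ (prefix2-as r k (suc n′) r≡))
  (wrap-< (∸-monoʳ-< {r} {n′} {0} 1≤n′ (≤-trans (n≤1+n n′) n≤r)))
  where
  open Reflection r 2≤r
  n≤r : suc n′ ≤ r
  n≤r = subst (suc n′ ≤_) r≡ (m≤m+n (suc n′) _)
  n<r : ∀ {i} → i < suc n′ → i < r
  n<r i<n = ≤-trans i<n n≤r

2k+1≤2m+1⇒k≤m : ∀ {k m} → 2 * k + 1 ≤ 2 * m + 1 → k ≤ m
2k+1≤2m+1⇒k≤m {k} {m} le = *-cancelˡ-≤ 2 (+-cancelʳ-≤ 1 (2 * k) (2 * m) le)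

twoColumnGG-ending : ∀ {r c L a} m → TwoColumnPath r c L a → 2 ≤ r → 2 ≤ c → hcount 0 L ≤ 2 * m + 1 →
                     ∃[ k ] k ≤ m × TwoColumnGG r c k a
twoColumnGG-ending {r} {c} {L} {a} m P 2≤r 2≤c hcount≤ with 3 ≤? r
... | no 3≰r = 0 , z≤n , subst (TwoColumnGG r c 0) (sym a≡0) (subst (λ r → TwoColumnGG r c 0 0) (sym r≡2) (form₁-toRow0 c 0 2≤c))
  where
  r≡2 : r ≡ 2
  r≡2 = ≤-antisym (≤-pred (≰⇒> 3≰r)) 2≤r
  a≡0 : a ≡ 0
  a≡0 = twoRows⇒end≡0 (subst (λ r → TwoColumnPath r c L a) r≡2 P)
... | yes 3≤r with a
...   | zero = 0 , z≤n , subst (λ r → TwoColumnGG r c 0 0) (m+[n∸m]≡n {2} {r} (<⇒≤ 3≤r)) (form₁-toRow0 c (r ∸ 2) 2≤c)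
...   | suc a′ with TwoColumns.endRowDichotomy P 3≤r a′ refl
...     | inj₁ (k , a′≡2k+1 , rungs) =
  k , 2k+1≤2m+1⇒k≤m (≤-trans (rungs≤hcount L 1 (2 * k + 1) rungs) hcount≤) ,
  subst (TwoColumnGG r c k) (m∸[m∸n]≡n (<⇒≤ a<r)) (form₂ r c k (r ∸ suc a′) 2≤c 2≤r r≡ (m<n⇒0<n∸m a<r))
  where
  a<r : suc a′ < r
  a<r = TwoColumnPath.a<r P
  r≡ : suc (r ∸ suc a′) + suc (2 * k) ≡ r
  r≡ = begin
    suc (r ∸ suc a′) + suc (2 * k)  ≡⟨ sym (+-suc (r ∸ suc a′) (suc (2 * k))) ⟩
    r ∸ suc a′ + suc (suc (2 * k))  ≡⟨ cong (λ x → r ∸ suc a′ + suc x) (trans (+-comm 1 (2 * k)) (sym a′≡2k+1)) ⟩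
    r ∸ suc a′ + suc a′             ≡⟨ m∸n+n≡m (<⇒≤ a<r) ⟩
    r                               ∎
    where open ≡-Reasoning
...     | inj₂ (k , d≡2k+1 , rungs) =
  k , 2k+1≤2m+1⇒k≤m (≤-trans (rungs≤hcount L (suc (suc a′)) (2 * k + 1) rungs) hcount≤) , form₁ r c k (suc a′) 2≤c r≡
  where
  a<r : suc a′ < r
  a<r = TwoColumnPath.a<r P
  r≡ : suc (suc a′) + suc (2 * k) ≡ r
  r≡ = trans (cong (suc (suc a′) +_) (trans (+-comm 1 (2 * k)) (sym d≡2k+1))) (m+[n∸m]≡n a<r)

-- Gluing a tail onto a two-column GG path

record Tail (r c a x : ℕ) (Bs : List V) : Set where
  field
    unique : Unique Bs
    inRange : All (InRange r c) Bs
    columns≥2 : All (λ v → 2 ≤ col v) Bs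
    covers : ∀ i j → i < r → 2 ≤ j → j < c → (i , j) ∈ Bs
    linked : Linked (Adj r c) ((a , 1) ∷ Bs)
    monotone : Linked _≤ᶜ_ ((a , 1) ∷ Bs)
    ends : EndsAt ((a , 1) ∷ Bs) (x , c ∸ 1)

Tail-hTotal : ∀ {r c a x Bs} → 2 ≤ c → Tail r c a x Bs → hTotal ((a , 1) ∷ Bs) ≡ c ∸ 2
Tail-hTotal {c = c} {a} {x} {Bs} 2≤c T = +-cancelʳ-≡ 1 _ _ (begin
  hTotal ((a , 1) ∷ Bs) + 1         ≡⟨ hTotal-columnMonotone (a , 1) Bs linked monotone ⟩
  col (lastOf (a , 1) Bs)            ≡⟨ cong col (lastOf-∷ʳ (a , 1) Bs _ _ (proj₂ ends)) ⟩
  c ∸ 1                              ≡⟨ trans (+-∸-assoc 1 2≤c) (+-comm 1 (c ∸ 2)) ⟩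
  c ∸ 2 + 1                          ∎)
  where
  open Tail T
  open ≡-Reasoning

column₁++right : ∀ xs ys → All (λ v → col v ≡ 1) xs → All (λ v → 2 ≤ col v) ys → Linked _≤ᶜ_ ys → Linked _≤ᶜ_ (xs ++ ys)
column₁++right [] ys _ _ l = l
column₁++right (x ∷ []) [] _ _ _ = [-]
column₁++right (x ∷ []) (y ∷ ys) (x≡1 ∷ _) (2≤y ∷ _) l = ≤-trans (≤-reflexive x≡1) (≤-trans (n≤1+n 1) 2≤y) ∷ l
column₁++right (x ∷ x′ ∷ xs) ys (x≡1 ∷ x′≡1 ∷ ≡1) ≥2 l = ≤-reflexive (trans x≡1 (sym x′≡1)) ∷ column₁++right (x′ ∷ xs) ys (x′≡1 ∷ ≡1) ≥2 l

glue : ∀ {r c k a x Bs} m → 2 ≤ c → k ≤ m → TwoColumnGG r c k a → Tail r c a x Bs → InA r c m x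
glue {r} {c} {k} {a} {x} {Bs} m 2≤c k≤m G T =
  path ++ Bs , k ,
  (2k+1≤r , (unique′ , inRange′ , covers′ , linked′) , hTotal′ , arc ++ Bs , shape′ , columnByColumn) ,
  subst (_≤ 2 * m + (c ∸ 1)) (sym hTotal′) bound , ends′
  where
  open TwoColumnGG G
  module T = Tail T
  W : List V
  W = proj₁ ends
  path≡ : path ≡ W ∷ʳ (a , 1)
  path≡ = proj₂ ends

  unique′ : Unique (path ++ Bs)
  unique′ = Unique.++⁺ unique T.unique λ (m₁ , m₂) → 1+n≰n (≤-trans (All.lookup T.columns≥2 m₂) (proj₂ (All.lookup inColumns m₁)))

  inRange′ : All (InRange r c) (path ++ Bs)
  inRange′ = All.++⁺ (All.map (λ (i<r , j≤1) → i<r , ≤-trans (s≤s j≤1) 2≤c) inColumns) T.inRange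

  covers′ : ∀ i j → i < r → j < c → (i , j) ∈ path ++ Bs
  covers′ i j i<r j<c with j ≤? 1
  ... | yes j≤1 = ∈-++⁺ˡ (covers i j i<r j≤1)
  ... | no j≰1 = ∈-++⁺ʳ path (T.covers i j i<r (≰⇒> j≰1) j<c)

  linked′ : Linked (Adj r c) (path ++ Bs)
  linked′ = subst (λ p → Linked (Adj r c) (p ++ Bs)) (sym path≡) (Linked-overlap W (a , 1) Bs (subst (Linked (Adj r c)) path≡ linked) T.linked)

  hTotal′ : hTotal (path ++ Bs) ≡ 2 * k + 1 + (c ∸ 2)
  hTotal′ = begin
    hTotal (path ++ Bs)                            ≡⟨ cong (λ p → hTotal (p ++ Bs)) path≡ ⟩
    hTotal ((W ∷ʳ (a , 1)) ++ Bs)                  ≡⟨ hTotal-++-overlap W (a , 1) Bs ⟩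
    hTotal (W ∷ʳ (a , 1)) + hTotal ((a , 1) ∷ Bs)  ≡⟨ cong₂ _+_ (trans (cong hTotal (sym path≡)) hTotal≡) (Tail-hTotal 2≤c T) ⟩
    2 * k + 1 + (c ∸ 2)                            ∎
    where open ≡-Reasoning

  shape′ : path ++ Bs ≡ prefix1 r k ++ (arc ++ Bs) ⊎ path ++ Bs ≡ prefix2 r k ++ (arc ++ Bs)
  shape′ with shape
  ... | inj₁ e = inj₁ (trans (cong (_++ Bs) e) (++-assoc (prefix1 r k) arc Bs))
  ... | inj₂ e = inj₂ (trans (cong (_++ Bs) e) (++-assoc (prefix2 r k) arc Bs))

  columnByColumn : ColumnByColumn (arc ++ Bs)
  columnByColumn = All.++⁺ (All.map (λ e → ≤-reflexive (sym e)) arc⊆column₁) (All.map (≤-trans (n≤1+n 1)) T.columns≥2) ,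
                   column₁++right arc Bs arc⊆column₁ T.columns≥2 (Linked.tail T.monotone)

  bound : 2 * k + 1 + (c ∸ 2) ≤ 2 * m + (c ∸ 1)
  bound = begin
    2 * k + 1 + (c ∸ 2)    ≡⟨ +-assoc (2 * k) 1 (c ∸ 2) ⟩
    2 * k + (1 + (c ∸ 2))  ≤⟨ +-monoˡ-≤ _ (*-monoʳ-≤ 2 k≤m) ⟩
    2 * m + (1 + (c ∸ 2))  ≡⟨ cong (2 * m +_) (sym (+-∸-assoc 1 2≤c)) ⟩
    2 * m + (c ∸ 1)        ∎
    where open ≤-Reasoning

  ends′ : EndsAt (path ++ Bs) (x , c ∸ 1)
  ends′ = W ++ proj₁ T.ends , (begin
    path ++ Bs                              ≡⟨ cong (_++ Bs) path≡ ⟩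
    (W ∷ʳ (a , 1)) ++ Bs                    ≡⟨ ++-assoc W [ a , 1 ] Bs ⟩
    W ++ (a , 1) ∷ Bs                       ≡⟨ cong (W ++_) (proj₂ T.ends) ⟩
    W ++ (proj₁ T.ends ∷ʳ (x , c ∸ 1))      ≡⟨ sym (++-assoc W (proj₁ T.ends) [ x , c ∸ 1 ]) ⟩
    (W ++ proj₁ T.ends) ∷ʳ (x , c ∸ 1)      ∎)
    where open ≡-Reasoning

record Decomposition (r c x : ℕ) (P : List V) : Set where
  field
    low high : List V
    split : P ≡ low ++ high
    exit : ℕ
    twoColumns : TwoColumnPath r c low exit
    tail : Tail r c exit x high

decompose-twoColumns : ∀ {r c x P} → 2 ≤ r → 2 ≤ c → HamPath r c P → StartsAt P (0 , 0) → EndsAt P (x , c ∸ 1) →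
                       All (λ v → col v ≤ 1) P → Decomposition r c x P
decompose-twoColumns {r} {c} {x} {P} 2≤r 2≤c (uP , rP , cP , lP) starts ends P≤1 = record
  { low = P ; high = [] ; split = sym (++-identityʳ P) ; exit = x
  ; twoColumns = record
    { unique = uP ; linked = lP ; columns≤1 = P≤1 ; starts = starts
    ; ends = subst (λ j → EndsAt P (x , j)) c∸1≡1 ends
    ; covers = λ i j i<r j≤1 → cP i j i<r (≤-trans (s≤s j≤1) 2≤c)
    ; a<r = proj₁ (All.lookup rP end∈P) }
  ; tail = record
    { unique = [] ; inRange = [] ; columns≥2 = []
    ; covers = λ i j _ 2≤j j<c → ⊥-elim (<⇒≱ j<c (subst (_≤ j) (sym c≡2) 2≤j))
    ; linked = [-] ; monotone = [-]
    ; ends = [] , cong (λ j → (x , j) ∷ []) (sym c∸1≡1) }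
  }
  where
  end∈P : (x , c ∸ 1) ∈ P
  end∈P = subst ((x , c ∸ 1) ∈_) (sym (proj₂ ends)) (∈-++⁺ʳ (proj₁ ends) (here refl))
  c∸1≡1 : c ∸ 1 ≡ 1
  c∸1≡1 = ≤-antisym (All.lookup P≤1 end∈P) (∸-monoˡ-≤ 1 2≤c)
  c≡2 : c ≡ 2
  c≡2 = trans (sym (m∸n+n≡m (≤-trans (s≤s z≤n) 2≤c))) (cong (_+ 1) c∸1≡1)

exitStep : ∀ {r c z y} → Adj r c z y → col z ≤ 1 → 2 ≤ col y → col z ≡ 1 × col y ≡ 2
exitStep {z = z} zy z≤1 2≤y with adj⇒columnStep zy
... | stay e = ⊥-elim (1+n≰n (≤-trans 2≤y (subst (_≤ 1) e z≤1)))
... | left e = ⊥-elim (1+n≰n (≤-trans (≤-trans 2≤y (n≤1+n _)) (subst (_≤ 1) (sym e) z≤1)))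
... | right e = z≡1 , trans (sym e) (cong suc z≡1)
  where
  z≡1 : col z ≡ 1
  z≡1 = ≤-antisym z≤1 (≤-pred (subst (2 ≤_) (sym e) 2≤y))

uncrossed⇒rightAndMonotone : ∀ {r c} y R → Linked (Adj r c) (y ∷ R) → col y ≡ 2 → hcount 1 (y ∷ R) ≡ 0 →
                             (∀ j → 2 ≤ j → suc j < c → hcount j (y ∷ R) ≤ 1) →
                             All (λ v → 2 ≤ col v) (y ∷ R) × Linked _≤ᶜ_ (y ∷ R)
uncrossed⇒rightAndMonotone y R l y≡2 uncrossed₁ once =
  staysRight , crossedOnce⇒columnMonotone 2 y R l staysRight
            (λ j 2≤j j<y → ⊥-elim (<⇒≱ j<y (subst (_≤ j) (sym y≡2) 2≤j)))
            (λ j y≤j j+1<c → once j (subst (_≤ j) y≡2 y≤j) j+1<c)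
  where
  staysRight : All (λ v → 2 ≤ col v) (y ∷ R)
  staysRight = uncrossed⇒staysRight 1 y R l (≤-reflexive (sym y≡2)) uncrossed₁

decompose-exit : ∀ {r c x} A0 z y R → let P = (A0 ∷ʳ z) ++ y ∷ R in
                 HamPath r c P → StartsAt P (0 , 0) → EndsAt P (x , c ∸ 1) →
                 (∀ j → 1 ≤ j → j ≤ c ∸ 2 → hcount j P ≡ 1) →
                 All (λ v → col v ≤ 1) (A0 ∷ʳ z) → 2 ≤ col y → Decomposition r c x P
decompose-exit {r} {c} {x} A0 z y R (uP , rP , cP , lP) starts ends once low≤1 2≤y = record
  { low = A0 ∷ʳ z ; high = y ∷ R ; split = refl ; exit = row z
  ; twoColumns = record
    { unique = Unique-++⁻ˡ (A0 ∷ʳ z) uP ; linked = Linked-++⁻ˡ (A0 ∷ʳ z) lP ; columns≤1 = low≤1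
    ; starts = StartsAt-∷ʳ-++ A0 z (y ∷ R) starts ; ends = A0 , cong (A0 ∷ʳ_) z≡
    ; covers = lowCovers ; a<r = proj₁ (adj-inRangeˡ zy) }
  ; tail = record
    { unique = Unique-++⁻ʳ (A0 ∷ʳ z) uP ; inRange = All.++⁻ʳ (A0 ∷ʳ z) rP ; columns≥2 = proj₁ rightPart
    ; covers = highCovers
    ; linked = subst (λ v → Adj r c v y) z≡ zy ∷ linkedHigh
    ; monotone = ≤-trans (s≤s z≤n) 2≤y ∷ proj₂ rightPart
    ; ends = subst (λ v → EndsAt (v ∷ y ∷ R) _) z≡ (EndsAt-suffix A0 z (y ∷ R) (subst (λ P → EndsAt P _) P≡ ends)) }
  }
  where
  P≡ : (A0 ∷ʳ z) ++ y ∷ R ≡ A0 ++ z ∷ y ∷ R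
  P≡ = ++-assoc A0 [ z ] (y ∷ R)
  zy : Adj r c z y
  zy = Linked-junction A0 z y R lP
  z₁ : col z ≡ 1 × col y ≡ 2
  z₁ = exitStep zy (All.lookup low≤1 (∈-++⁺ʳ A0 (here refl))) 2≤y
  z≡ : z ≡ (row z , 1)
  z≡ = cong (row z ,_) (proj₁ z₁)
  3≤c : 3 ≤ c
  3≤c = subst (λ j → suc j ≤ c) (proj₂ z₁) (proj₂ (adj-inRangeʳ zy))
  linkedHigh : Linked (Adj r c) (y ∷ R)
  linkedHigh = Linked-++⁻ʳ (A0 ∷ʳ z) lP
  uncrossed₁ : hcount 1 (y ∷ R) ≡ 0
  uncrossed₁ = n≤0⇒n≡0 (≤-pred (begin
    suc (hcount 1 (y ∷ R))         ≡⟨ cong (λ b → ⟦ b ⟧ + hcount 1 (y ∷ R)) (sym (isHj-right 1 z y (proj₁ z₁) (proj₂ z₁))) ⟩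
    hcount 1 (z ∷ y ∷ R)           ≤⟨ hcount-++ʳ-≤ 1 A0 (z ∷ y ∷ R) ⟩
    hcount 1 (A0 ++ z ∷ y ∷ R)     ≡⟨ cong (hcount 1) (sym P≡) ⟩
    hcount 1 ((A0 ∷ʳ z) ++ y ∷ R)  ≡⟨ once 1 ≤-refl (∸-monoˡ-≤ 2 3≤c) ⟩
    1                              ∎))
    where open ≤-Reasoning
  rightPart : All (λ v → 2 ≤ col v) (y ∷ R) × Linked _≤ᶜ_ (y ∷ R)
  rightPart = uncrossed⇒rightAndMonotone y R linkedHigh (proj₂ z₁) uncrossed₁ λ j 2≤j j+1<c →
    ≤-trans (hcount-++ʳ-≤ j (A0 ∷ʳ z) (y ∷ R)) (≤-reflexive (once j (≤-trans (s≤s z≤n) 2≤j) (∸-monoˡ-≤ 2 j+1<c)))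
  lowCovers : ∀ i j → i < r → j ≤ 1 → (i , j) ∈ A0 ∷ʳ z
  lowCovers i j i<r j≤1 with ∈-++⁻ (A0 ∷ʳ z) (cP i j i<r (≤-trans (s≤s j≤1) (≤-trans (n≤1+n 2) 3≤c)))
  ... | inj₁ m = m
  ... | inj₂ m = ⊥-elim (1+n≰n (≤-trans (All.lookup (proj₁ rightPart) m) j≤1))
  highCovers : ∀ i j → i < r → 2 ≤ j → j < c → (i , j) ∈ y ∷ R
  highCovers i j i<r 2≤j j<c with ∈-++⁻ (A0 ∷ʳ z) (cP i j i<r j<c)
  ... | inj₁ m = ⊥-elim (1+n≰n (≤-trans 2≤j (All.lookup low≤1 m)))
  ... | inj₂ m = m

decompose : ∀ {r c x P} → 2 ≤ r → 2 ≤ c → HamPath r c P → StartsAt P (0 , 0) → EndsAt P (x , c ∸ 1) →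
            (∀ j → 1 ≤ j → j ≤ c ∸ 2 → hcount j P ≡ 1) → Decomposition r c x P
decompose {P = P} 2≤r 2≤c H starts ends once with columnSplit P
... | mkColumnSplit A [] refl A≤1 _ rewrite ++-identityʳ A = decompose-twoColumns 2≤r 2≤c H starts ends A≤1
... | mkColumnSplit A (y ∷ R) refl A≤1 (inj₂ (_ , _ , refl , 2≤y)) with initLast A
...   | A0 ∷ʳ′ z = decompose-exit A0 z y R H starts ends once A≤1 2≤y
...   | [] with ∷-injectiveˡ (proj₂ starts)
...     | refl with 2≤y
...       | ()

proposition12 : (r c m x : ℕ) (P : List V) → 2 ≤ r → 2 ≤ c →
    HamPath r c P → StartsAt P (0 , 0) → EndsAt P (x , c ∸ 1) →
    hcount 0 P ≡ 2 * m + 1 →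
    (∀ j → 1 ≤ j → j ≤ c ∸ 2 → hcount j P ≡ 1) →
    InA r c m x
proposition12 r c m x P 2≤r 2≤c H starts ends rungs once =
  let k , k≤m , G = twoColumnGG-ending m twoColumns 2≤r 2≤c lowRungs in glue m 2≤c k≤m G tail
  where
  open Decomposition (decompose 2≤r 2≤c H starts ends once)
  lowRungs : hcount 0 low ≤ 2 * m + 1
  lowRungs = ≤-trans (hcount-++ˡ-≤ 0 low high) (≤-reflexive (trans (cong (hcount 0) (sym split)) rungs))
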